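{- The language $L\subseteq\{a,b\}^*$ given by the regular expression $(a(ab)^*b)^*$ is definable in $FO[<]$ but not in $FO^2[<,\mathrm{bet}]$.
   Context: $FO[<]$ is first-order logic over finite words with the order $<$ on positions and unary predicates $a(x)$, $b(x)$ for the letter at position $x$. $FO^2[<,\mathrm{bet}]$ is its fragment using only two (reusable) variable symbols, extended with binary predicates $c(x,y)$ for each letter $c$, meaning some position strictly between $x$ and $y$ carries the letter $c$. -}

module Defs where

open import Data.Nat using (ℕ; zero; suc; _<_)
open import Data.Fin using (Fin)
open import Data.List using (List; []; _∷_; _++_)
open import Data.Maybe using (Maybe; just; nothing)
open import Data.Bool using (Bool; true; false; T)
open import Data.Product using (Σ; _×_; ∃)
open import Data.Sum using (_⊎_)
open import Data.Empty using (⊥)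
open import Relation.Nullary using (¬_)
open import Relation.Binary.PropositionalEquality using (_≡_)
open import Function.Bundles using (_⇔_)
open import Data.Vec.Functional using () renaming (_∷_ to _∷ᵥ_)

data Letter : Set where
  a b : Letter

Word : Set
Word = List Letter

at : Word → ℕ → Maybe Letter
at []      _       = nothing
at (c ∷ w) zero    = just c
at (c ∷ w) (suc i) = at w i

length : Word → ℕ
length []      = 0
length (_ ∷ w) = suc (length w)

Between : Word → Letter → ℕ → ℕ → Set
Between w c i j = ∃ λ k → ((i < k × k < j) ⊎ (j < k × k < i)) × at w k ≡ just c

data InABStar : Word → Set where
  nil  : InABStar []
  cons : ∀ {w} → InABStar w → InABStar (a ∷ b ∷ w)

data InL : Word → Set where
  nil  : InL []
  cons : ∀ {u v} → InABStar u → InL v → InL (a ∷ u ++ (b ∷ v))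

-- FO[<] : first-order logic with <, =, letter predicates
-- (de Bruijn variables; FO n = formulas with n free variables)

data FO (n : ℕ) : Set where
  letter : Letter → Fin n → FO n
  lt     : Fin n → Fin n → FO n
  eq     : Fin n → Fin n → FO n
  neg    : FO n → FO n
  and    : FO n → FO n → FO n
  ex     : FO (suc n) → FO n

satFO : ∀ {n} → FO n → Word → (Fin n → ℕ) → Set
satFO (letter c x) w ρ = at w (ρ x) ≡ just c
satFO (lt x y)     w ρ = ρ x < ρ y
satFO (eq x y)     w ρ = ρ x ≡ ρ y
satFO (neg φ)      w ρ = ¬ satFO φ w ρ
satFO (and φ ψ)    w ρ = satFO φ w ρ × satFO ψ w ρ
satFO (ex φ)       w ρ = ∃ λ i → i < length w × satFO φ w (i ∷ᵥ ρ)

noVars : Fin 0 → ℕ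
noVars ()

FODefinable : (Word → Set) → Set
FODefinable L = Σ (FO 0) λ φ → ∀ w → L w ⇔ satFO φ w noVars

-- FO²[<,bet] : two reusable variable symbols x, y, with <, =,
-- letter predicates, and between predicates c(x,y).
-- Formulas are indexed by the scope (which of x, y are bound).

data V2 : Set where
  vx vy : V2

Scope : Set
Scope = V2 → Bool

bind : Scope → V2 → Scope
bind Γ vx vx = true
bind Γ vx vy = Γ vy
bind Γ vy vx = Γ vx
bind Γ vy vy = true

Assign : Scope → Set
Assign Γ = (v : V2) → T (Γ v) → ℕ

extend : ∀ {Γ} → Assign Γ → (v : V2) → ℕ → Assign (bind Γ v)
extend ρ vx i vx _ = i
extend ρ vx i vy p = ρ vy p
extend ρ vy i vx p = ρ vx p
extend ρ vy i vy _ = i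

data FO2 (Γ : Scope) : Set where
  letter : Letter → (u : V2) → T (Γ u) → FO2 Γ
  lt     : (u v : V2) → T (Γ u) → T (Γ v) → FO2 Γ
  eq     : (u v : V2) → T (Γ u) → T (Γ v) → FO2 Γ
  bet    : Letter → (u v : V2) → T (Γ u) → T (Γ v) → FO2 Γ
  neg    : FO2 Γ → FO2 Γ
  and    : FO2 Γ → FO2 Γ → FO2 Γ
  ex     : (u : V2) → FO2 (bind Γ u) → FO2 Γ

satFO2 : ∀ {Γ} → FO2 Γ → Word → Assign Γ → Set
satFO2 (letter c u p)  w ρ = at w (ρ u p) ≡ just c
satFO2 (lt u v p q)    w ρ = ρ u p < ρ v q
satFO2 (eq u v p q)    w ρ = ρ u p ≡ ρ v q
satFO2 (bet c u v p q) w ρ = Between w c (ρ u p) (ρ v q)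
satFO2 (neg φ)         w ρ = ¬ satFO2 φ w ρ
satFO2 (and φ ψ)       w ρ = satFO2 φ w ρ × satFO2 ψ w ρ
satFO2 (ex u φ)        w ρ = ∃ λ i → i < length w × satFO2 φ w (extend ρ u i)

emptyScope : Scope
emptyScope _ = false

noVars2 : Assign emptyScope
noVars2 _ ()

FO2BetDefinable : (Word → Set) → Set
FO2BetDefinable L = Σ (FO2 emptyScope) λ φ → ∀ w → L w ⇔ satFO2 φ w noVars2

{-# OPTIONS --safe #-}
-- L is the set of balanced words of nesting depth at most 2, reading a as an
-- opening and b as a closing bracket. First-order logic can say this: such a
-- word starts with a, ends with b, and its factors aa and bb alternate,
-- beginning with aa and ending with bb.
--
-- For quantifier depth k take u = C₀^(2K+1) ∈ L and the
-- word v ∉ L obtained by turning one factor abab into aabb. Duplicator wins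
-- the k-round two-pebble game on u and v by keeping the two pebbles of a pair
-- either on the same position or both deep inside the words, with equal
-- neighbourhoods of radius 4(j + 1) when j rounds remain. Long moves are
-- answered using the periodicity of u, and around the modification v looks
-- like a part of v that agrees with u. Since both letters occur in every
-- factor of length 3, the between predicates cannot tell far pairs apart.
module Submission where

open import Defs
open import Data.Nat using (ℕ; zero; suc; _+_; _*_; _∸_; _≤_; _<_; _≤‴_; ≤‴-refl; ≤‴-step; z≤n; s≤s; _⊔_; _≤?_; _<?_; _≟_; NonZero; _/_; _%_; >-nonZero)
open import Data.Nat.Properties
open import Data.Nat.DivMod using (m≡m%n+[m/n]*n; m%n<n)
open import Data.Nat.Tactic.RingSolver using (solve-∀)
open import Data.Bool using (T)
open import Data.Fin using (Fin; zero; suc)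
open import Data.List using ([]; _∷_; _++_)
open import Data.List.Properties using (++-assoc)
open import Data.Maybe using (Maybe; just; nothing)
import Data.Maybe.Properties as Maybe
open import Data.Product using (Σ; _×_; _,_; ∃; proj₁; proj₂)
open import Data.Sum using (_⊎_; inj₁; inj₂)
open import Data.Empty using (⊥-elim)
open import Data.Vec.Functional using () renaming (_∷_ to _∷ᵥ_)
open import Relation.Nullary using (¬_; Dec; yes; no)
open import Relation.Nullary.Decidable using (¬?; _×-dec_)
open import Relation.Binary.PropositionalEquality
open import Function using (_∘_)
open import Function.Bundles using (_⇔_; mk⇔; Equivalence)

no-bounded-ascent : ∀ {P : ℕ → Set} n → (∀ {p} → P p → p < n) →
                    (∀ {p} → P p → ∃ λ q → p < q × P q) → ∀ {p} → ¬ P p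
no-bounded-ascent {P} n bounded ascend {p} = go n (m≤m+n n p)
  where
  go : ∀ f {p} → n ≤ f + p → ¬ P p
  go zero    n≤p Pp = <⇒≱ (bounded Pp) n≤p
  go (suc f) {p} n≤ Pp with ascend Pp
  ... | q , p<q , Pq = go f (≤-trans n≤ (≤-trans (≤-reflexive (sym (+-suc f p))) (+-monoʳ-≤ f p<q))) Pq

-- The depth automaton

-- sᵢ is the current depth; dead records depth 3 or an unmatched b.
data State : Set where
  s0 s1 s2 dead : State

step : State → Letter → State
step s0   a = s1
step s1   a = s2
step s2   a = dead
step s0   b = dead
step s1   b = s0
step s2   b = s1
step dead _ = dead

run : State → Word → State
run s []      = s
run s (c ∷ w) = run (step s c) w

run-++ : ∀ s u v → run s (u ++ v) ≡ run (run s u) v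
run-++ s []      v = refl
run-++ s (c ∷ u) v = run-++ (step s c) u v

run-dead : ∀ w → run dead w ≡ dead
run-dead []      = refl
run-dead (c ∷ w) = run-dead w

run-++-≡ : ∀ {s t r} u v → run s u ≡ t → run t v ≡ r → run s (u ++ v) ≡ r
run-++-≡ {s} u v e e′ = trans (run-++ s u v) (trans (cong (λ t → run t v) e) e′)

run-dead≢s0 : ∀ w → run dead w ≢ s0
run-dead≢s0 w e with trans (sym (run-dead w)) e
... | ()

InABStar⇒run : ∀ {u} → InABStar u → run s1 u ≡ s1
InABStar⇒run nil      = refl
InABStar⇒run (cons p) = InABStar⇒run p

InL⇒run : ∀ {w} → InL w → run s0 w ≡ s0
InL⇒run nil = refl
InL⇒run (cons {u} {v} pu pv) = run-++-≡ u (b ∷ v) (InABStar⇒run pu) (InL⇒run pv)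

mutual
  run⇒InL : ∀ w → run s0 w ≡ s0 → InL w
  run⇒InL []      _ = nil
  run⇒InL (a ∷ w) e with run-s1⇒block w e
  ... | u , v , refl , pu , pv = cons pu pv
  run⇒InL (b ∷ w) e = ⊥-elim (run-dead≢s0 w e)

  run-s1⇒block : ∀ w → run s1 w ≡ s0 →
                 Σ Word λ u → Σ Word λ v → w ≡ u ++ b ∷ v × InABStar u × InL v
  run-s1⇒block []          ()
  run-s1⇒block (b ∷ w)     e = [] , w , refl , nil , run⇒InL w e
  run-s1⇒block (a ∷ [])    ()
  run-s1⇒block (a ∷ a ∷ w) e = ⊥-elim (run-dead≢s0 w e)
  run-s1⇒block (a ∷ b ∷ w) e with run-s1⇒block w e
  ... | u , v , refl , pu , pv = a ∷ b ∷ u , v , refl , cons pu , pv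

other : Letter → Letter
other a = b
other b = a

letter-cases : ∀ c d → d ≡ c ⊎ d ≡ other c
letter-cases a a = inj₁ refl
letter-cases a b = inj₂ refl
letter-cases b a = inj₂ refl
letter-cases b b = inj₁ refl

-- A factor cc can only be read from state before c to state after c.
before after : Letter → State
before a = s0
before b = s2
after a = s2
after b = s0

before≢after : ∀ c → before c ≢ after c
before≢after a ()
before≢after b ()

s1≢after : ∀ c → s1 ≢ after c
s1≢after a ()
s1≢after b ()

after≢dead : ∀ c → after c ≢ dead
after≢dead a ()
after≢dead b ()

step-before : ∀ c d → step (before c) d ≡ dead ⊎ d ≡ c × step (before c) d ≡ s1
step-before a a = inj₂ (refl , refl)
step-before a b = inj₁ refl
step-before b a = inj₁ refl
step-before b b = inj₂ (refl , refl)

step-s1 : ∀ c d → d ≡ c × step s1 d ≡ after c ⊎ step s1 d ≡ before c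
step-s1 a a = inj₁ (refl , refl)
step-s1 a b = inj₂ refl
step-s1 b a = inj₂ refl
step-s1 b b = inj₁ (refl , refl)

step-before-self : ∀ c → step (before c) c ≡ s1
step-before-self a = refl
step-before-self b = refl

step-s1-self : ∀ c → step s1 c ≡ after c
step-s1-self a = refl
step-s1-self b = refl

step-twice : ∀ c s → step (step s c) c ≢ dead → s ≡ before c
step-twice a s0   _     = refl
step-twice a s1   alive = ⊥-elim (alive refl)
step-twice a s2   alive = ⊥-elim (alive refl)
step-twice a dead alive = ⊥-elim (alive refl)
step-twice b s0   alive = ⊥-elim (alive refl)
step-twice b s1   alive = ⊥-elim (alive refl)
step-twice b s2   _     = refl
step-twice b dead alive = ⊥-elim (alive refl)

before-other : ∀ c → before (other c) ≡ after c
before-other a = refl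
before-other b = refl

after-other : ∀ c → after (other c) ≡ before c
after-other a = refl
after-other b = refl

s1≢before : ∀ c → s1 ≢ before c
s1≢before a ()
s1≢before b ()

step-other≢after : ∀ c s → step s (other c) ≢ after c
step-other≢after a s0   ()
step-other≢after a s1   ()
step-other≢after a s2   ()
step-other≢after a dead ()
step-other≢after b s0   ()
step-other≢after b s1   ()
step-other≢after b s2   ()
step-other≢after b dead ()

step-dies : ∀ s c → s ≢ dead → step s c ≡ dead → s ≡ after c
step-dies s0   a _     ()
step-dies s1   a _     ()
step-dies s2   a _     _ = refl
step-dies s0   b _     _ = refl
step-dies s1   b _     ()
step-dies s2   b _     ()
step-dies dead c alive _ = ⊥-elim (alive refl)

step-thrice : ∀ c s → step (step (step s c) c) c ≡ dead
step-thrice a s0   = refl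
step-thrice a s1   = refl
step-thrice a s2   = refl
step-thrice a dead = refl
step-thrice b s0   = refl
step-thrice b s1   = refl
step-thrice b s2   = refl
step-thrice b dead = refl


dead? : ∀ s → Dec (s ≡ dead)
dead? s0   = no λ ()
dead? s1   = no λ ()
dead? s2   = no λ ()
dead? dead = yes refl

-- Past the end of the word the state is dead, so a live state at i
-- certifies i ≤ length w.
next : State → Maybe Letter → State
next s nothing  = dead
next s (just c) = step s c

stateFrom : State → Word → ℕ → State
stateFrom s w zero    = s
stateFrom s w (suc i) = next (stateFrom s w i) (at w i)

stateFrom-cons : ∀ s c w i → stateFrom s (c ∷ w) (suc i) ≡ stateFrom (step s c) w i
stateFrom-cons s c w zero    = refl
stateFrom-cons s c w (suc i) = cong (λ t → next t (at w i)) (stateFrom-cons s c w i)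

stateFrom-length : ∀ s w → stateFrom s w (length w) ≡ run s w
stateFrom-length s []      = refl
stateFrom-length s (c ∷ w) = trans (stateFrom-cons s c w (length w)) (stateFrom-length (step s c) w)

stateAt : Word → ℕ → State
stateAt = stateFrom s0

stateAt-step : ∀ w i {c s} → at w i ≡ just c → stateAt w i ≡ s → stateAt w (suc i) ≡ step s c
stateAt-step w i ei es = cong₂ next es ei

stateAt-view : ∀ w i → stateAt w (suc i) ≡ dead ⊎ ∃ λ c → at w i ≡ just c × stateAt w (suc i) ≡ step (stateAt w i) c
stateAt-view w i with at w i
... | nothing = inj₁ refl
... | just c  = inj₂ (c , refl , refl)

at-just⇒< : ∀ {w i c} → at w i ≡ just c → i < length w
at-just⇒< {_ ∷ w} {zero}  e = s≤s z≤n
at-just⇒< {_ ∷ w} {suc i} e = s≤s (at-just⇒< {w} e)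

<⇒at-just : ∀ {w i} → i < length w → ∃ λ c → at w i ≡ just c
<⇒at-just {c ∷ w} {zero}  _       = c , refl
<⇒at-just {c ∷ w} {suc i} (s≤s p) = <⇒at-just {w} p

next-dead : ∀ m → next dead m ≡ dead
next-dead nothing  = refl
next-dead (just a) = refl
next-dead (just b) = refl

stateAt-dead : ∀ w {i} j → i ≤ j → stateAt w i ≡ dead → stateAt w j ≡ dead
stateAt-dead w zero    z≤n   e = e
stateAt-dead w (suc j) i≤1+j e with m≤n⇒m<n∨m≡n i≤1+j
... | inj₂ refl       = e
... | inj₁ (s≤s i≤j) = trans (cong (λ s → next s (at w j)) (stateAt-dead w j i≤j e)) (next-dead (at w j))

alive-before : ∀ w {i j} → i ≤ j → stateAt w j ≢ dead → stateAt w i ≢ dead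
alive-before w {j = j} i≤j alive = alive ∘ stateAt-dead w j i≤j

first-death : ∀ w n → stateAt w n ≡ dead →
              ∃ λ t → t < n × stateAt w t ≢ dead × stateAt w (suc t) ≡ dead
first-death w zero    ()
first-death w (suc n) dies with dead? (stateAt w n)
... | no alive = n , ≤-refl , alive , dies
... | yes deadₙ with first-death w n deadₙ
...   | t , t<n , rest = t , m<n⇒m<1+n t<n , rest

leave-before : ∀ w c i → stateAt w i ≡ before c →
               stateAt w (suc i) ≡ dead ⊎ at w i ≡ just c × stateAt w (suc i) ≡ s1
leave-before w c i e with stateAt-view w i
... | inj₁ dies = inj₁ dies
... | inj₂ (d , di , e′) with step-before c d
...   | inj₁ dies        = inj₁ (trans e′ (trans (cong (λ s → step s d) e) dies))
...   | inj₂ (refl , e₁) = inj₂ (di , trans e′ (trans (cong (λ s → step s d) e) e₁))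

leave-s1 : ∀ w c i → stateAt w i ≡ s1 →
           stateAt w (suc i) ≡ dead ⊎ at w i ≡ just c × stateAt w (suc i) ≡ after c ⊎ stateAt w (suc i) ≡ before c
leave-s1 w c i e with stateAt-view w i
... | inj₁ dies = inj₁ dies
... | inj₂ (d , di , e′) with step-s1 c d
...   | inj₁ (refl , e₁) = inj₂ (inj₁ (di , trans e′ (trans (cong (λ s → step s d) e) e₁)))
...   | inj₂ e₁          = inj₂ (inj₂ (trans e′ (trans (cong (λ s → step s d) e) e₁)))

DoubleAt : Word → Letter → ℕ → Set
DoubleAt w c p = at w p ≡ just c × at w (suc p) ≡ just c

DoubleAt⇒< : ∀ {w c p} → DoubleAt w c p → 2 + p ≤ length w
DoubleAt⇒< {w} (_ , e) = at-just⇒< {w} e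

-- A discrete intermediate value theorem: the depth cannot climb from
-- before c to after c without reading cc.
double-between : ∀ w c {i j} → i ≤ j → stateAt w i ≡ before c → stateAt w j ≡ after c →
                 ∃ λ p → i ≤ p × 2 + p ≤ j × DoubleAt w c p
double-between w c i≤j = go (≤⇒≤‴ i≤j)
  where
  go : ∀ {i j} → i ≤‴ j → stateAt w i ≡ before c → stateAt w j ≡ after c →
       ∃ λ p → i ≤ p × 2 + p ≤ j × DoubleAt w c p
  go ≤‴-refl eb ea = ⊥-elim (before≢after c (trans (sym eb) ea))
  go {i} (≤‴-step ≤‴-refl) eb ea with leave-before w c i eb
  ... | inj₁ dies      = ⊥-elim (after≢dead c (trans (sym ea) dies))
  ... | inj₂ (_ , e₁) = ⊥-elim (s1≢after c (trans (sym e₁) ea))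
  go {i} (≤‴-step (≤‴-step i+2≤j)) eb ea with leave-before w c i eb
  ... | inj₁ dies = ⊥-elim (after≢dead c (trans (sym ea) (stateAt-dead w _ (≤‴⇒≤ (≤‴-step i+2≤j)) dies)))
  ... | inj₂ (ci , e₁) with leave-s1 w c (suc i) e₁
  ...   | inj₁ dies = ⊥-elim (after≢dead c (trans (sym ea) (stateAt-dead w _ (≤‴⇒≤ i+2≤j) dies)))
  ...   | inj₂ (inj₁ (ci′ , _)) = i , ≤-refl , ≤‴⇒≤ i+2≤j , ci , ci′
  ...   | inj₂ (inj₂ e₂) with go i+2≤j e₂ ea
  ...     | p , i+2≤p , p+2≤j , cc = p , ≤-trans (m≤n+m i 2) i+2≤p , p+2≤j , cc

double-states : ∀ w c p → DoubleAt w c p → stateAt w (2 + p) ≢ dead →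
                stateAt w p ≡ before c × stateAt w (suc p) ≡ s1 × stateAt w (2 + p) ≡ after c
double-states w c p (cp , cp′) alive = e₀ , e₁ , e₂
  where
  e₀ : stateAt w p ≡ before c
  e₀ = step-twice c (stateAt w p) (alive ∘ trans (stateAt-step w (suc p) cp′ (stateAt-step w p cp refl)))
  e₁ : stateAt w (suc p) ≡ s1
  e₁ = trans (stateAt-step w p cp e₀) (step-before-self c)
  e₂ : stateAt w (2 + p) ≡ after c
  e₂ = trans (stateAt-step w (suc p) cp′ e₁) (step-s1-self c)

Dense : Word → Set
Dense w = ∀ x c → 3 + x < length w → ∃ λ r → 0 < r × r ≤ 3 × at w (x + r) ≡ just c

live⇒dense : ∀ w → stateAt w (length w) ≢ dead → Dense w
live⇒dense w alive x c x+3<ℓ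
  with <⇒at-just {w} {1 + x} (≤-trans (m≤n+m (2 + x) 2) x+3<ℓ)
     | <⇒at-just {w} {2 + x} (≤-trans (m≤n+m (3 + x) 1) x+3<ℓ)
     | <⇒at-just {w} {3 + x} x+3<ℓ
... | d₁ , e₁ | d₂ , e₂ | d₃ , e₃ with letter-cases c d₁ | letter-cases c d₂ | letter-cases c d₃
... | inj₁ refl | _         | _         = 1 , s≤s z≤n , s≤s z≤n , subst (λ i → at w i ≡ just c) (+-comm 1 x) e₁
... | inj₂ _    | inj₁ refl | _         = 2 , s≤s z≤n , s≤s (s≤s z≤n) , subst (λ i → at w i ≡ just c) (+-comm 2 x) e₂
... | inj₂ _    | inj₂ _    | inj₁ refl = 3 , s≤s z≤n , ≤-refl , subst (λ i → at w i ≡ just c) (+-comm 3 x) e₃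
... | inj₂ refl | inj₂ refl | inj₂ refl = ⊥-elim (alive-before w x+3<ℓ alive dies)
  where
  dies : stateAt w (4 + x) ≡ dead
  dies = trans (stateAt-step w (3 + x) e₃ (stateAt-step w (2 + x) e₂ (stateAt-step w (1 + x) e₁ refl)))
               (step-thrice (other c) (stateAt w (1 + x)))

-- A first-order definition of L

record Shape (w : Word) : Set where
  field
    first        : 0 < length w → at w 0 ≡ just a
    last         : ∀ x → suc x ≡ length w → at w x ≡ just b
    alternate    : ∀ c {p q} → p < q → DoubleAt w c p → DoubleAt w c q →
                   ∃ λ r → p < r × r < q × DoubleAt w (other c) r
    aa-before-bb : ∀ {q} → DoubleAt w b q → ∃ λ p → p < q × DoubleAt w a p
    bb-after-aa  : ∀ {p} → DoubleAt w a p → ∃ λ q → p < q × DoubleAt w b q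

module _ {w : Word} (final : stateAt w (length w) ≡ s0) where
  private
    alive : ∀ {i} → i ≤ length w → stateAt w i ≢ dead
    alive i≤ = alive-before w i≤ (after≢dead b ∘ trans (sym final))

    states : ∀ c {p} → DoubleAt w c p →
             stateAt w p ≡ before c × stateAt w (suc p) ≡ s1 × stateAt w (2 + p) ≡ after c
    states c {p} cc = double-states w c p cc (alive (DoubleAt⇒< {w} cc))

  run⇒first : 0 < length w → at w 0 ≡ just a
  run⇒first 0<ℓ with <⇒at-just {w} 0<ℓ
  ... | a , e = e
  ... | b , e = ⊥-elim (alive 0<ℓ (stateAt-step w 0 e refl))

  run⇒last : ∀ x → suc x ≡ length w → at w x ≡ just b
  run⇒last x x+1≡ℓ with <⇒at-just {w} (≤-reflexive x+1≡ℓ)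
  ... | b , e = e
  ... | a , e = ⊥-elim (step-other≢after b (stateAt w x) (trans (sym (stateAt-step w x e refl)) (trans (cong (stateAt w) x+1≡ℓ) final)))

  run⇒alternate : ∀ c {p q} → p < q → DoubleAt w c p → DoubleAt w c q →
              ∃ λ r → p < r × r < q × DoubleAt w (other c) r
  run⇒alternate c {p} {q} p<q cp cq with states c cp | states c cq
  ... | _ , at₁ , at₂ | atq , _ with double-between w (other c) p+2≤q (trans at₂ (sym (before-other c))) (trans atq (sym (after-other c)))
    where
    p+2≤q : 2 + p ≤ q
    p+2≤q with m≤n⇒m<n∨m≡n p<q
    ... | inj₁ p+1<q = p+1<q
    ... | inj₂ refl  = ⊥-elim (s1≢before c (trans (sym at₁) atq))
  ... | r , p+2≤r , r+2≤q , cr = r , ≤-trans (n≤1+n _) p+2≤r , ≤-trans (n≤1+n _) r+2≤q , cr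

  run⇒aa-before-bb : ∀ {q} → DoubleAt w b q → ∃ λ p → p < q × DoubleAt w a p
  run⇒aa-before-bb {q} cq with double-between w a z≤n refl (proj₁ (states b cq))
  ... | p , _ , p+2≤q , cp = p , ≤-trans (n≤1+n _) p+2≤q , cp

  run⇒bb-after-aa : ∀ {p} → DoubleAt w a p → ∃ λ q → p < q × DoubleAt w b q
  run⇒bb-after-aa {p} cp with double-between w b (DoubleAt⇒< {w} cp) (proj₂ (proj₂ (states a cp))) final
  ... | q , p+2≤q , _ , cq = q , ≤-trans (n≤1+n _) p+2≤q , cq

  run⇒Shape : Shape w
  run⇒Shape = record
    { first        = run⇒first
    ; last         = run⇒last
    ; alternate    = run⇒alternate
    ; aa-before-bb = run⇒aa-before-bb
    ; bb-after-aa  = run⇒bb-after-aa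
    }

module _ {w : Word} (S : Shape w) where
  open Shape S

  private
    alive-until : ∀ {c q j} → stateAt w q ≡ after c → j ≤ q → stateAt w j ≢ dead
    alive-until {c} over j≤q = alive-before w j≤q (after≢dead c ∘ trans (sym over))

  start-before : ∀ c {q} → DoubleAt w c q → stateAt w (suc q) ≡ after c →
                 ∃ λ i → i ≤ suc q × stateAt w i ≡ before c
  start-before a _  _    = 0 , z≤n , refl
  start-before b cq over with aa-before-bb cq
  ... | p , p<q , cp = 2 + p , s≤s p<q , proj₂ (proj₂ (double-states w a p cp (alive-until over (s≤s p<q))))

  -- Between any earlier cc and the one at q lies a factor (other c)(other c),
  -- after which the depth has to climb through yet another cc below q.
  no-overshoot : ∀ c {q} → DoubleAt w c q → stateAt w (suc q) ≢ after c
  no-overshoot c {q} cq over =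
    let i , i≤ , atᵢ = start-before c cq over
        _ , _ , Pp   = earlier i≤ atᵢ
    in no-bounded-ascent q proj₂ ascend Pp
    where
    earlier : ∀ {i} → i ≤ suc q → stateAt w i ≡ before c →
              ∃ λ p → i ≤ p × DoubleAt w c p × p < q
    earlier i≤ e with double-between w c i≤ e over
    ... | p , i≤p , p+2≤ , cp = p , i≤p , cp , ≤-pred p+2≤

    ascend : ∀ {p} → DoubleAt w c p × p < q → ∃ λ p′ → p < p′ × DoubleAt w c p′ × p′ < q
    ascend (cp , p<q) with alternate c p<q cp cq
    ... | r , p<r , r<q , cr
        with earlier (s≤s r<q) (trans (proj₂ (proj₂ (double-states w (other c) r cr (alive-until over (s≤s r<q))))) (after-other c))
    ...   | p′ , r+2≤p′ , rest = p′ , <-trans p<r (≤-trans (n≤1+n _) r+2≤p′) , rest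

  no-death : ∀ {t} → t < length w → stateAt w t ≢ dead → stateAt w (suc t) ≢ dead
  no-death {t} t<ℓ alive dies with <⇒at-just {w} t<ℓ
  ... | c , e with step-dies (stateAt w t) c alive (trans (sym (stateAt-step w t e refl)) dies)
  no-death {zero}   t<ℓ alive dies | a , e | ()
  no-death {zero}   t<ℓ alive dies | b , e | _ with trans (sym (first t<ℓ)) e
  ... | ()
  no-death {suc t′} t<ℓ alive dies | c , e | over with <⇒at-just {w} {t′} (<-trans (n<1+n t′) t<ℓ)
  ... | d , e′ with letter-cases c d
  ...   | inj₁ refl = no-overshoot c (e′ , e) over
  ...   | inj₂ refl = step-other≢after c (stateAt w t′) (trans (sym (stateAt-step w t′ e′ refl)) over)

  alive-everywhere : ∀ i → i ≤ length w → stateAt w i ≢ dead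
  alive-everywhere zero    _     = λ ()
  alive-everywhere (suc i) i<ℓ = no-death i<ℓ (alive-everywhere i (≤-trans (n≤1+n i) i<ℓ))

  -- As in no-overshoot, with the trailing b playing the role of the second c.
  not-s2-before-last : ∀ x → suc x ≡ length w → stateAt w x ≢ s2
  not-s2-before-last x x+1≡ℓ atₓ with double-between w a z≤n refl atₓ
  ... | p , _ , p+2≤x , cp = no-bounded-ascent x bounded ascend (cp , p+2≤x)
    where
    atℓ : stateAt w (suc x) ≡ s1
    atℓ = trans (stateAt-step w x (last x x+1≡ℓ) atₓ) refl

    bounded : ∀ {p} → DoubleAt w a p × 2 + p ≤ x → p < x
    bounded (_ , p+2≤x) = ≤-trans (n≤1+n _) p+2≤x

    ascend : ∀ {p} → DoubleAt w a p × 2 + p ≤ x → ∃ λ p′ → p < p′ × DoubleAt w a p′ × 2 + p′ ≤ x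
    ascend (cp , _) with bb-after-aa cp
    ... | q , p<q , cq with double-states w b q cq (alive-everywhere _ (DoubleAt⇒< {w} cq))
    ...   | _ , _ , at₀ with double-between w a q+2≤x at₀ atₓ
      where
      q+2≤x : 2 + q ≤ x
      q+2≤x with m≤n⇒m<n∨m≡n (≤-trans (DoubleAt⇒< {w} cq) (≤-reflexive (sym x+1≡ℓ)))
      ... | inj₁ (s≤s le) = le
      ... | inj₂ refl     = ⊥-elim (s1≢before a (trans (sym atℓ) at₀))
    ...     | p′ , q+2≤p′ , p′+2≤x , cp′ = p′ , <-trans p<q (≤-trans (n≤1+n _) q+2≤p′) , cp′ , p′+2≤x

  Shape⇒run : stateAt w (length w) ≡ s0
  Shape⇒run with length w in eℓ
  ... | zero  = refl
  ... | suc x with stateAt w x in atₓ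
  ...   | s0   = ⊥-elim (alive-everywhere (suc x) (≤-reflexive (sym eℓ)) (stateAt-step w x (last x (sym eℓ)) atₓ))
  ...   | s1   = cong (next s1) (last x (sym eℓ))
  ...   | s2   = ⊥-elim (not-s2-before-last x (sym eℓ) atₓ)
  ...   | dead = ⊥-elim (alive-everywhere x (≤-trans (n≤1+n x) (≤-reflexive (sym eℓ))) atₓ)

_≟ᴸ_ : (c d : Letter) → Dec (c ≡ d)
a ≟ᴸ a = yes refl
a ≟ᴸ b = no λ ()
b ≟ᴸ a = no λ ()
b ≟ᴸ b = yes refl

satFO? : ∀ {n} (φ : FO n) w ρ → Dec (satFO φ w ρ)
satFO? (letter c x) w ρ = Maybe.≡-dec _≟ᴸ_ (at w (ρ x)) (just c)
satFO? (lt x y)     w ρ = ρ x <? ρ y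
satFO? (eq x y)     w ρ = ρ x ≟ ρ y
satFO? (neg φ)      w ρ = ¬? (satFO? φ w ρ)
satFO? (and φ ψ)    w ρ = satFO? φ w ρ ×-dec satFO? ψ w ρ
satFO? (ex φ)       w ρ = anyUpTo? (λ i → satFO? φ w (i ∷ᵥ ρ)) (length w)

imp : ∀ {n} → FO n → FO n → FO n
imp φ ψ = neg (and φ (neg ψ))

all : ∀ {n} → FO (suc n) → FO n
all φ = neg (ex (neg φ))

imp-intro : ∀ {n} (φ ψ : FO n) w ρ → (satFO φ w ρ → satFO ψ w ρ) → satFO (imp φ ψ) w ρ
imp-intro φ ψ w ρ f (sφ , ¬sψ) = ¬sψ (f sφ)

imp-elim : ∀ {n} (φ ψ : FO n) w ρ → satFO (imp φ ψ) w ρ → satFO φ w ρ → satFO ψ w ρ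
imp-elim φ ψ w ρ s sφ with satFO? ψ w ρ
... | yes sψ = sψ
... | no ¬sψ = ⊥-elim (s (sφ , ¬sψ))

all-intro : ∀ {n} (φ : FO (suc n)) w ρ → (∀ i → i < length w → satFO φ w (i ∷ᵥ ρ)) → satFO (all φ) w ρ
all-intro φ w ρ f (i , i<ℓ , ¬sφ) = ¬sφ (f i i<ℓ)

all-elim : ∀ {n} (φ : FO (suc n)) w ρ → satFO (all φ) w ρ → ∀ i → i < length w → satFO φ w (i ∷ᵥ ρ)
all-elim φ w ρ s i i<ℓ with satFO? φ w (i ∷ᵥ ρ)
... | yes sφ = sφ
... | no ¬sφ = ⊥-elim (s (i , i<ℓ , ¬sφ))

allImp-intro : ∀ {n} (φ ψ : FO (suc n)) w ρ →
               (∀ i → i < length w → satFO φ w (i ∷ᵥ ρ) → satFO ψ w (i ∷ᵥ ρ)) → satFO (all (imp φ ψ)) w ρ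
allImp-intro φ ψ w ρ f = all-intro (imp φ ψ) w ρ λ i i<ℓ → imp-intro φ ψ w (i ∷ᵥ ρ) (f i i<ℓ)

allImp-elim : ∀ {n} (φ ψ : FO (suc n)) w ρ → satFO (all (imp φ ψ)) w ρ →
              ∀ i → i < length w → satFO φ w (i ∷ᵥ ρ) → satFO ψ w (i ∷ᵥ ρ)
allImp-elim φ ψ w ρ s i i<ℓ = imp-elim φ ψ w (i ∷ᵥ ρ) (all-elim (imp φ ψ) w ρ s i i<ℓ)

x₀ : ∀ {n} → Fin (suc n)
x₀ = zero

x₁ : ∀ {n} → Fin (suc (suc n))
x₁ = suc zero

x₂ : ∀ {n} → Fin (suc (suc (suc n)))
x₂ = suc (suc zero)

successor : ∀ {n} → Fin n → Fin n → FO n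
successor i j = and (lt i j) (neg (ex (and (lt (suc i) x₀) (lt x₀ (suc j)))))

double : ∀ {n} → Letter → Fin n → FO n
double c i = and (letter c i) (ex (and (successor (suc i) x₀) (letter c x₀)))

double⇒DoubleAt : ∀ {n} c (i : Fin n) w ρ → satFO (double c i) w ρ → DoubleAt w c (ρ i)
double⇒DoubleAt c i w ρ (cᵢ , q , q<ℓ , (p<q , nothing-between) , c_q) = cᵢ , subst (λ r → at w r ≡ just c) q≡p+1 c_q
  where
  q≡p+1 : q ≡ suc (ρ i)
  q≡p+1 with m≤n⇒m<n∨m≡n p<q
  ... | inj₂ e      = sym e
  ... | inj₁ p+1<q = ⊥-elim (nothing-between (suc (ρ i) , <-trans p+1<q q<ℓ , ≤-refl , p+1<q))

DoubleAt⇒double : ∀ {n} c (i : Fin n) w ρ → DoubleAt w c (ρ i) → satFO (double c i) w ρ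
DoubleAt⇒double c i w ρ (cₚ , cₚ₊₁) = cₚ , suc (ρ i) , at-just⇒< {w} cₚ₊₁ , (≤-refl , nothing-between) , cₚ₊₁
  where
  nothing-between : ¬ ∃ λ r → r < length w × ρ i < r × r < suc (ρ i)
  nothing-between (r , _ , p<r , s≤s r≤p) = <⇒≱ p<r r≤p

is-first is-last : FO 1
is-first = neg (ex (lt x₀ x₁))
is-last  = neg (ex (lt x₁ x₀))

double-before double-after : Letter → FO 1
double-before c = ex (and (lt x₀ x₁) (double c x₀))
double-after  c = ex (and (lt x₁ x₀) (double c x₀))

two-doubles double-inside : Letter → FO 2
two-doubles   c = and (lt x₁ x₀) (and (double c x₁) (double c x₀))
double-inside c = ex (and (and (lt x₂ x₀) (lt x₀ x₁)) (double c x₀))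

alternating : Letter → FO 0
alternating c = all (all (imp (two-doubles c) (double-inside (other c))))

shape : FO 0
shape = and (all (imp is-first (letter a x₀)))
       (and (all (imp is-last (letter b x₀)))
       (and (alternating a)
       (and (alternating b)
       (and (all (imp (double b x₀) (double-before a)))
            (all (imp (double a x₀) (double-after b)))))))

module _ (w : Word) where
  alternating⇒ : ∀ c → satFO (alternating c) w noVars → ∀ {p q} → p < q → DoubleAt w c p → DoubleAt w c q →
                 ∃ λ r → p < r × r < q × DoubleAt w (other c) r
  alternating⇒ c s {p} {q} p<q cp cq
    with allImp-elim (two-doubles c) (double-inside (other c)) w (p ∷ᵥ noVars)
           (all-elim (all (imp (two-doubles c) (double-inside (other c)))) w noVars s p (at-just⇒< {w} (proj₁ cp))) q (at-just⇒< {w} (proj₁ cq))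
           (p<q , DoubleAt⇒double c x₁ w (q ∷ᵥ p ∷ᵥ noVars) cp , DoubleAt⇒double c x₀ w (q ∷ᵥ p ∷ᵥ noVars) cq)
  ... | r , _ , (p<r , r<q) , cr = r , p<r , r<q , double⇒DoubleAt (other c) x₀ w (r ∷ᵥ q ∷ᵥ p ∷ᵥ noVars) cr

  ⇒alternating : ∀ c → (∀ {p q} → p < q → DoubleAt w c p → DoubleAt w c q →
                        ∃ λ r → p < r × r < q × DoubleAt w (other c) r) →
                 satFO (alternating c) w noVars
  ⇒alternating c alt = all-intro (all (imp (two-doubles c) (double-inside (other c)))) w noVars λ p _ → allImp-intro (two-doubles c) (double-inside (other c)) w (p ∷ᵥ noVars)
    λ q _ (p<q , cp , cq) →
      let r , p<r , r<q , cr = alt p<q (double⇒DoubleAt c x₁ w (q ∷ᵥ p ∷ᵥ noVars) cp) (double⇒DoubleAt c x₀ w (q ∷ᵥ p ∷ᵥ noVars) cq)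
      in r , at-just⇒< {w} (proj₁ cr) , (p<r , r<q) , DoubleAt⇒double (other c) x₀ w (r ∷ᵥ q ∷ᵥ p ∷ᵥ noVars) cr

  shape⇒Shape : satFO shape w noVars → Shape w
  shape⇒Shape (s-first , s-last , s-alt-a , s-alt-b , s-before , s-after) = record
    { first        = λ 0<ℓ → allImp-elim is-first (letter a x₀) w noVars s-first 0 0<ℓ λ { (_ , _ , ()) }
    ; last         = λ x x+1≡ℓ → allImp-elim is-last (letter b x₀) w noVars s-last x (≤-reflexive x+1≡ℓ)
                       λ (y , y<ℓ , x<y) → <⇒≱ y<ℓ (subst (_≤ y) x+1≡ℓ x<y)
    ; alternate    = λ { a → alternating⇒ a s-alt-a ; b → alternating⇒ b s-alt-b }
    ; aa-before-bb = λ {q} cq →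
        let p , _ , p<q , cp = allImp-elim (double b x₀) (double-before a) w noVars s-before q (at-just⇒< {w} (proj₁ cq))
                                 (DoubleAt⇒double b x₀ w (q ∷ᵥ noVars) cq)
        in p , p<q , double⇒DoubleAt a x₀ w (p ∷ᵥ q ∷ᵥ noVars) cp
    ; bb-after-aa  = λ {p} cp →
        let q , _ , p<q , cq = allImp-elim (double a x₀) (double-after b) w noVars s-after p (at-just⇒< {w} (proj₁ cp))
                                 (DoubleAt⇒double a x₀ w (p ∷ᵥ noVars) cp)
        in q , p<q , double⇒DoubleAt b x₀ w (q ∷ᵥ p ∷ᵥ noVars) cq
    }

  Shape⇒shape : Shape w → satFO shape w noVars
  Shape⇒shape S = s-first , s-last , ⇒alternating a (alternate a) , ⇒alternating b (alternate b) , s-before , s-after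
    where
    open Shape S
    s-first : satFO (all (imp is-first (letter a x₀))) w noVars
    s-first = allImp-intro is-first (letter a x₀) w noVars first-letter
      where
      first-letter : ∀ i → i < length w → ¬ ∃ (λ j → j < length w × j < i) → at w i ≡ just a
      first-letter zero    0<ℓ _           = first 0<ℓ
      first-letter (suc i) i<ℓ none-before = ⊥-elim (none-before (0 , <-trans (s≤s z≤n) i<ℓ , s≤s z≤n))

    s-last : satFO (all (imp is-last (letter b x₀))) w noVars
    s-last = allImp-intro is-last (letter b x₀) w noVars last-letter
      where
      last-letter : ∀ i → i < length w → ¬ ∃ (λ j → j < length w × i < j) → at w i ≡ just b
      last-letter i i<ℓ none-after with m≤n⇒m<n∨m≡n i<ℓ
      ... | inj₂ i+1≡ℓ = last i i+1≡ℓ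
      ... | inj₁ i+1<ℓ = ⊥-elim (none-after (suc i , i+1<ℓ , ≤-refl))

    s-before : satFO (all (imp (double b x₀) (double-before a))) w noVars
    s-before = allImp-intro (double b x₀) (double-before a) w noVars λ q _ cq →
      let p , p<q , cp = aa-before-bb (double⇒DoubleAt b x₀ w (q ∷ᵥ noVars) cq)
      in p , at-just⇒< {w} (proj₁ cp) , p<q , DoubleAt⇒double a x₀ w (p ∷ᵥ q ∷ᵥ noVars) cp

    s-after : satFO (all (imp (double a x₀) (double-after b))) w noVars
    s-after = allImp-intro (double a x₀) (double-after b) w noVars λ p _ cp →
      let q , p<q , cq = bb-after-aa (double⇒DoubleAt a x₀ w (p ∷ᵥ noVars) cp)
      in q , at-just⇒< {w} (proj₁ cq) , p<q , DoubleAt⇒double b x₀ w (q ∷ᵥ p ∷ᵥ noVars) cq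

L-FO-definable : FODefinable InL
L-FO-definable = shape , λ w → mk⇔
  (λ w∈L → Shape⇒shape w (run⇒Shape (trans (stateFrom-length s0 w) (InL⇒run w∈L))))
  (λ s → run⇒InL w (trans (sym (stateFrom-length s0 w)) (Shape⇒run (shape⇒Shape w s))))

-- Ehrenfeucht–Fraïssé games for FO²[<,bet]

qdepth : ∀ {Γ} → FO2 Γ → ℕ
qdepth (letter _ _ _)  = 0
qdepth (lt _ _ _ _)    = 0
qdepth (eq _ _ _ _)    = 0
qdepth (bet _ _ _ _ _) = 0
qdepth (neg φ)         = qdepth φ
qdepth (and φ ψ)       = qdepth φ ⊔ qdepth ψ
qdepth (ex _ φ)        = suc (qdepth φ)

val : V2 → ℕ → ℕ → ℕ
val vx x y = x
val vy x y = y

Agree : ∀ {Γ} → Assign Γ → ℕ → ℕ → Set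
Agree {Γ} ρ x y = ∀ v (p : T (Γ v)) → ρ v p ≡ val v x y

Agree-extend-x : ∀ {Γ} {ρ : Assign Γ} {x y} i → Agree ρ x y → Agree (extend ρ vx i) i y
Agree-extend-x i A vx _ = refl
Agree-extend-x i A vy p = A vy p

Agree-extend-y : ∀ {Γ} {ρ : Assign Γ} {x y} i → Agree ρ x y → Agree (extend ρ vy i) x i
Agree-extend-y i A vx p = A vx p
Agree-extend-y i A vy _ = refl

-- Distances above 4 need not be matched exactly: in the words compared here
-- both letters occur strictly between positions more than 4 apart.
SameGap : ℕ → ℕ → ℕ → ℕ → Set
SameGap x y x′ y′ = (∃ λ t → t ≤ 4 × y ≡ x + t × y′ ≡ x′ + t)
                  ⊎ (∃ λ t → t ≤ 4 × x ≡ y + t × x′ ≡ y′ + t)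
                  ⊎ (x + 4 < y × x′ + 4 < y′)
                  ⊎ (y + 4 < x × y′ + 4 < x′)

SameGap-swap : ∀ {x y x′ y′} → SameGap x y x′ y′ → SameGap y x y′ x′
SameGap-swap (inj₁ g)               = inj₂ (inj₁ g)
SameGap-swap (inj₂ (inj₁ g))        = inj₁ g
SameGap-swap (inj₂ (inj₂ (inj₁ g))) = inj₂ (inj₂ (inj₂ g))
SameGap-swap (inj₂ (inj₂ (inj₂ g))) = inj₂ (inj₂ (inj₁ g))

SameGap-sym : ∀ {x y x′ y′} → SameGap x y x′ y′ → SameGap x′ y′ x y
SameGap-sym (inj₁ (t , t≤4 , e , e′))        = inj₁ (t , t≤4 , e′ , e)
SameGap-sym (inj₂ (inj₁ (t , t≤4 , e , e′))) = inj₂ (inj₁ (t , t≤4 , e′ , e))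
SameGap-sym (inj₂ (inj₂ (inj₁ (l , l′))))    = inj₂ (inj₂ (inj₁ (l′ , l)))
SameGap-sym (inj₂ (inj₂ (inj₂ (l , l′))))    = inj₂ (inj₂ (inj₂ (l′ , l)))

SameGap-< : ∀ {x y x′ y′} → SameGap x y x′ y′ → x < y → x′ < y′
SameGap-< (inj₁ (zero , _ , refl , refl))       x<x   = ⊥-elim (<-irrefl (sym (+-identityʳ _)) x<x)
SameGap-< (inj₁ (suc t , _ , refl , refl))      _     = m<m+n _ (s≤s z≤n)
SameGap-< (inj₂ (inj₁ (t , _ , refl , refl)))   y+t<y = ⊥-elim (m+n≮m _ t y+t<y)
SameGap-< (inj₂ (inj₂ (inj₁ (_ , x′+4<y′))))   _     = ≤-<-trans (m≤m+n _ 4) x′+4<y′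
SameGap-< (inj₂ (inj₂ (inj₂ (y+4<x , _))))     x<y   = ⊥-elim (<-asym x<y (≤-<-trans (m≤m+n _ 4) y+4<x))

SameGap-≡ : ∀ {x y x′ y′} → SameGap x y x′ y′ → x ≡ y → x′ ≡ y′
SameGap-≡ (inj₁ (zero , _ , refl , refl))      _    = sym (+-identityʳ _)
SameGap-≡ (inj₁ (suc t , _ , refl , refl))     x≡y  = ⊥-elim (m+1+n≢m _ (sym x≡y))
SameGap-≡ (inj₂ (inj₁ (zero , _ , refl , refl)))  _   = +-identityʳ _
SameGap-≡ (inj₂ (inj₁ (suc t , _ , refl , refl))) x≡y = ⊥-elim (m+1+n≢m _ x≡y)
SameGap-≡ (inj₂ (inj₂ (inj₁ (x+4<x , _)))) refl = ⊥-elim (m+n≮m _ 4 x+4<x)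
SameGap-≡ (inj₂ (inj₂ (inj₂ (x+4<x , _)))) refl = ⊥-elim (m+n≮m _ 4 x+4<x)

Between-sym : ∀ {w c i j} → Between w c i j → Between w c j i
Between-sym (k , inj₁ x , e) = k , inj₂ x , e
Between-sym (k , inj₂ x , e) = k , inj₁ x , e

Between-irrefl : ∀ {w c x} → ¬ Between w c x x
Between-irrefl (k , inj₁ (l₁ , l₂) , _) = <-asym l₁ l₂
Between-irrefl (k , inj₂ (l₁ , l₂) , _) = <-asym l₁ l₂

Converse : (ℕ → ℕ → ℕ → Set) → ℕ → ℕ → ℕ → Set
Converse R j p p′ = R j p′ p

-- R j p p′: with j rounds left, position p of w₁ is matched by p′ of w₂.
-- Moves of at most 4 are copied, longer moves are answered by long moves.
record Simulation (w₁ w₂ : Word) (R : ℕ → ℕ → ℕ → Set) : Set where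
  field
    same-letter  : ∀ {j p p′} → R j p p′ → at w₁ p ≡ at w₂ p′
    near-between : ∀ {j p p′} → R j p p′ → ∀ t → t ≤ 4 → ∀ c →
                   Between w₁ c p (p + t) → Between w₂ c p′ (p′ + t)
    far-between  : ∀ {j p p′} → R j p p′ → ∀ q q′ → p + 4 < q → p′ + 4 < q′ →
                   q < length w₁ → q′ < length w₂ → ∀ c → Between w₂ c p′ q′
    weaken       : ∀ {j p p′} → R (suc j) p p′ → R j p p′
    shift-right  : ∀ {j p p′} → R (suc j) p p′ → ∀ t → t ≤ 4 → p + t < length w₁ →
                   R j (p + t) (p′ + t)
    shift-left   : ∀ {j p p′} → R (suc j) p p′ → ∀ t → t ≤ 4 → t ≤ p →
                   t ≤ p′ × R j (p ∸ t) (p′ ∸ t)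
    jump-left    : ∀ {j p p′} → R (suc j) p p′ → ∀ i → i < length w₁ → i + 4 < p →
                   ∃ λ i′ → i′ < length w₂ × i′ + 4 < p′ × R j i i′
    jump-right   : ∀ {j p p′} → R (suc j) p p′ → ∀ i → i < length w₁ → p + 4 < i →
                   ∃ λ i′ → i′ < length w₂ × p′ + 4 < i′ × R j i i′

Simulation-resp : ∀ {w₁ w₂ R R′} → (∀ {j p p′} → R j p p′ → R′ j p p′) → (∀ {j p p′} → R′ j p p′ → R j p p′) →
                  Simulation w₁ w₂ R → Simulation w₁ w₂ R′
Simulation-resp f g S = record
  { same-letter  = λ r → same-letter (g r)
  ; near-between = λ r → near-between (g r)
  ; far-between  = λ r → far-between (g r)
  ; weaken       = λ r → f (weaken (g r))
  ; shift-right  = λ r t t≤4 p+t<ℓ → f (shift-right (g r) t t≤4 p+t<ℓ)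
  ; shift-left   = λ r t t≤4 t≤p → let t≤p′ , r′ = shift-left (g r) t t≤4 t≤p in t≤p′ , f r′
  ; jump-left    = λ r i i<ℓ i+4<p → let i′ , i′<ℓ , i′+4<p′ , r′ = jump-left (g r) i i<ℓ i+4<p in i′ , i′<ℓ , i′+4<p′ , f r′
  ; jump-right   = λ r i i<ℓ p+4<i → let i′ , i′<ℓ , p′+4<i′ , r′ = jump-right (g r) i i<ℓ p+4<i in i′ , i′<ℓ , p′+4<i′ , f r′
  }
  where open Simulation S

module _ {w₁ w₂ R} (S : Simulation w₁ w₂ R) where
  open Simulation S

  matched-in-range : ∀ {j p p′} → R j p p′ → p < length w₁ → p′ < length w₂
  matched-in-range r p<ℓ with <⇒at-just {w₁} p<ℓ
  ... | c , e = at-just⇒< {w₂} (trans (sym (same-letter r)) e)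

  SameGap-between : ∀ {j x y x′ y′} → R j x x′ → R j y y′ → SameGap x y x′ y′ →
                    x < length w₁ → y < length w₁ → x′ < length w₂ → y′ < length w₂ →
                    ∀ c → Between w₁ c x y → Between w₂ c x′ y′
  SameGap-between rx ry (inj₁ (t , t≤4 , refl , refl))        _ _ _ _ c bt = near-between rx t t≤4 c bt
  SameGap-between rx ry (inj₂ (inj₁ (t , t≤4 , refl , refl))) _ _ _ _ c bt =
    Between-sym {w₂} (near-between ry t t≤4 c (Between-sym {w₁} bt))
  SameGap-between rx ry (inj₂ (inj₂ (inj₁ (l , l′)))) _ y<ℓ _ y′<ℓ c _ = far-between rx _ _ l l′ y<ℓ y′<ℓ c
  SameGap-between rx ry (inj₂ (inj₂ (inj₂ (l , l′)))) x<ℓ _ x′<ℓ _ c _ =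
    Between-sym {w₂} (far-between ry _ _ l l′ x<ℓ x′<ℓ c)

  answer : ∀ {j q q′} → R (suc j) q q′ → ∀ i → i < length w₁ →
           ∃ λ i′ → i′ < length w₂ × R j i i′ × SameGap i q i′ q′
  answer {j} {q} {q′} r i i<ℓ with q ≤? i
  ... | yes q≤i with i ≤? q + 4
  ...   | yes i≤q+4 = q′ + t , matched-in-range r′ (subst (_< length w₁) i≡q+t i<ℓ) ,
                      subst (λ z → R j z (q′ + t)) (sym i≡q+t) r′ , inj₂ (inj₁ (t , t≤4 , i≡q+t , refl))
    where
    t = i ∸ q
    i≡q+t : i ≡ q + t
    i≡q+t = sym (m+[n∸m]≡n q≤i)
    t≤4 : t ≤ 4
    t≤4 = ≤-trans (∸-monoˡ-≤ q i≤q+4) (≤-reflexive (m+n∸m≡n q 4))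
    r′ : R j (q + t) (q′ + t)
    r′ = shift-right r t t≤4 (subst (_< length w₁) i≡q+t i<ℓ)
  ...   | no i≰q+4 with jump-right r i i<ℓ (≰⇒> i≰q+4)
  ...     | i′ , i′<ℓ , q′+4<i′ , r′ = i′ , i′<ℓ , r′ , inj₂ (inj₂ (inj₂ (≰⇒> i≰q+4 , q′+4<i′)))
  answer {j} {q} {q′} r i i<ℓ | no q≰i with q ≤? i + 4
  ...   | yes q≤i+4 = q′ ∸ t , matched-in-range r′ (subst (_< length w₁) i≡q-t i<ℓ) ,
                      subst (λ z → R j z (q′ ∸ t)) (sym i≡q-t) r′ ,
                      inj₁ (t , t≤4 , sym (trans (cong (_+ t) i≡q-t) (m∸n+n≡m t≤q)) , sym (m∸n+n≡m t≤q′))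
    where
    t = q ∸ i
    i≤q : i ≤ q
    i≤q = <⇒≤ (≰⇒> q≰i)
    t≤q : t ≤ q
    t≤q = m∸n≤m q i
    i≡q-t : i ≡ q ∸ t
    i≡q-t = sym (m∸[m∸n]≡n i≤q)
    t≤4 : t ≤ 4
    t≤4 = ≤-trans (∸-monoˡ-≤ i q≤i+4) (≤-reflexive (m+n∸m≡n i 4))
    t≤q′ : t ≤ q′
    t≤q′ = proj₁ (shift-left r t t≤4 t≤q)
    r′ : R j (q ∸ t) (q′ ∸ t)
    r′ = proj₂ (shift-left r t t≤4 t≤q)
  ...   | no q≰i+4 with jump-left r i i<ℓ (≰⇒> q≰i+4)
  ...     | i′ , i′<ℓ , i′+4<q′ , r′ = i′ , i′<ℓ , r′ , inj₂ (inj₂ (inj₁ (≰⇒> q≰i+4 , i′+4<q′)))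

record Configuration (w₁ w₂ : Word) (R : ℕ → ℕ → ℕ → Set) (j x y x′ y′ : ℕ) : Set where
  constructor configuration
  field
    matched-x : R j x x′
    matched-y : R j y y′
    gap       : SameGap x y x′ y′
    x<ℓ       : x < length w₁
    y<ℓ       : y < length w₁

module _ {w₁ w₂ R} (S : Simulation w₁ w₂ R) {j x y x′ y′} (C : Configuration w₁ w₂ R j x y x′ y′) where
  open Configuration C

  x′<ℓ : x′ < length w₂
  x′<ℓ = matched-in-range S matched-x x<ℓ

  y′<ℓ : y′ < length w₂
  y′<ℓ = matched-in-range S matched-y y<ℓ

  Configuration-converse : Configuration w₂ w₁ (Converse R) j x′ y′ x y
  Configuration-converse = configuration matched-x matched-y (SameGap-sym gap) x′<ℓ y′<ℓ

  val-matched : ∀ v → R j (val v x y) (val v x′ y′)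
  val-matched vx = matched-x
  val-matched vy = matched-y

  val-< : ∀ u v → val u x y < val v x y → val u x′ y′ < val v x′ y′
  val-< vx vx x<x = ⊥-elim (<-irrefl refl x<x)
  val-< vx vy x<y = SameGap-< gap x<y
  val-< vy vx y<x = SameGap-< (SameGap-swap gap) y<x
  val-< vy vy y<y = ⊥-elim (<-irrefl refl y<y)

  val-≡ : ∀ u v → val u x y ≡ val v x y → val u x′ y′ ≡ val v x′ y′
  val-≡ vx vx _   = refl
  val-≡ vx vy x≡y = SameGap-≡ gap x≡y
  val-≡ vy vx y≡x = SameGap-≡ (SameGap-swap gap) y≡x
  val-≡ vy vy _   = refl

  val-between : ∀ c u v → Between w₁ c (val u x y) (val v x y) → Between w₂ c (val u x′ y′) (val v x′ y′)
  val-between c vx vx bt = ⊥-elim (Between-irrefl {w₁} bt)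
  val-between c vx vy bt = SameGap-between S matched-x matched-y gap x<ℓ y<ℓ x′<ℓ y′<ℓ c bt
  val-between c vy vx bt = SameGap-between S matched-y matched-x (SameGap-swap gap) y<ℓ x<ℓ y′<ℓ x′<ℓ c bt
  val-between c vy vy bt = ⊥-elim (Between-irrefl {w₁} bt)

-- The Ehrenfeucht–Fraïssé argument; negation swaps the two simulations.
simulation-preserves : ∀ {w₁ w₂ R} → Simulation w₁ w₂ R → Simulation w₂ w₁ (Converse R) →
                       ∀ {Γ} (φ : FO2 Γ) j → qdepth φ ≤ j → ∀ (ρ₁ ρ₂ : Assign Γ) x y x′ y′ →
                       Agree ρ₁ x y → Agree ρ₂ x′ y′ → Configuration w₁ w₂ R j x y x′ y′ →
                       satFO2 φ w₁ ρ₁ → satFO2 φ w₂ ρ₂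
simulation-preserves {w₁} {w₂} S S′ (letter c u p) j _ ρ₁ ρ₂ x y x′ y′ A₁ A₂ C s =
  trans (cong (at w₂) (A₂ u p)) (trans (sym (Simulation.same-letter S (val-matched S C u))) (trans (cong (at w₁) (sym (A₁ u p))) s))
simulation-preserves S S′ (lt u v p q) j _ ρ₁ ρ₂ x y x′ y′ A₁ A₂ C s =
  subst₂ _<_ (sym (A₂ u p)) (sym (A₂ v q)) (val-< S C u v (subst₂ _<_ (A₁ u p) (A₁ v q) s))
simulation-preserves S S′ (eq u v p q) j _ ρ₁ ρ₂ x y x′ y′ A₁ A₂ C s =
  trans (A₂ u p) (trans (val-≡ S C u v (trans (sym (A₁ u p)) (trans s (A₁ v q)))) (sym (A₂ v q)))
simulation-preserves {w₁} {w₂} S S′ (bet c u v p q) j _ ρ₁ ρ₂ x y x′ y′ A₁ A₂ C s =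
  subst₂ (Between w₂ c) (sym (A₂ u p)) (sym (A₂ v q)) (val-between S C c u v (subst₂ (Between w₁ c) (A₁ u p) (A₁ v q) s))
simulation-preserves S S′ (neg φ) j d≤j ρ₁ ρ₂ x y x′ y′ A₁ A₂ C s s₂ =
  s (simulation-preserves S′ S φ j d≤j ρ₂ ρ₁ x′ y′ x y A₂ A₁ (Configuration-converse S C) s₂)
simulation-preserves S S′ (and φ ψ) j d≤j ρ₁ ρ₂ x y x′ y′ A₁ A₂ C (sφ , sψ) =
  simulation-preserves S S′ φ j (m⊔n≤o⇒m≤o (qdepth φ) (qdepth ψ) d≤j) ρ₁ ρ₂ x y x′ y′ A₁ A₂ C sφ ,
  simulation-preserves S S′ ψ j (m⊔n≤o⇒n≤o (qdepth φ) (qdepth ψ) d≤j) ρ₁ ρ₂ x y x′ y′ A₁ A₂ C sψ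
simulation-preserves S S′ (ex vx φ) (suc j) (s≤s d≤j) ρ₁ ρ₂ x y x′ y′ A₁ A₂ C (i , i<ℓ , sφ)
  with answer S (Configuration.matched-y C) i i<ℓ
... | i′ , i′<ℓ , rᵢ , gap = i′ , i′<ℓ ,
      simulation-preserves S S′ φ j d≤j _ _ i y i′ y′ (Agree-extend-x i A₁) (Agree-extend-x i′ A₂)
        (configuration rᵢ (Simulation.weaken S (Configuration.matched-y C)) gap i<ℓ (Configuration.y<ℓ C)) sφ
simulation-preserves S S′ (ex vy φ) (suc j) (s≤s d≤j) ρ₁ ρ₂ x y x′ y′ A₁ A₂ C (i , i<ℓ , sφ)
  with answer S (Configuration.matched-x C) i i<ℓ
... | i′ , i′<ℓ , rᵢ , gap = i′ , i′<ℓ ,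
      simulation-preserves S S′ φ j d≤j _ _ x i x′ i′ (Agree-extend-y i A₁) (Agree-extend-y i′ A₂)
        (configuration (Simulation.weaken S (Configuration.matched-x C)) rᵢ (SameGap-swap gap) (Configuration.x<ℓ C) i<ℓ) sφ

-- The words u and v

length-++ : ∀ u v → length (u ++ v) ≡ length u + length v
length-++ []      v = refl
length-++ (c ∷ u) v = cong suc (length-++ u v)

at-++ˡ : ∀ u v i → i < length u → at (u ++ v) i ≡ at u i
at-++ˡ (c ∷ u) v zero    _       = refl
at-++ˡ (c ∷ u) v (suc i) (s≤s l) = at-++ˡ u v i l

at-++ʳ : ∀ u v i → at (u ++ v) (length u + i) ≡ at v i
at-++ʳ []      v i = refl
at-++ʳ (c ∷ u) v i = at-++ʳ u v i

at-++-≥ : ∀ u v i → length u ≤ i → at (u ++ v) i ≡ at v (i ∸ length u)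
at-++-≥ u v i ℓ≤i = trans (cong (at (u ++ v)) (sym (m+[n∸m]≡n ℓ≤i))) (at-++ʳ u v (i ∸ length u))

repeat : ℕ → Word → Word
repeat zero    w = []
repeat (suc n) w = w ++ repeat n w

length-repeat : ∀ n w → length (repeat n w) ≡ n * length w
length-repeat zero    w = refl
length-repeat (suc n) w = trans (length-++ w (repeat n w)) (cong (length w +_) (length-repeat n w))

repeat-+ : ∀ m n w → repeat m w ++ repeat n w ≡ repeat (m + n) w
repeat-+ zero    n w = refl
repeat-+ (suc m) n w = trans (++-assoc w (repeat m w) (repeat n w)) (cong (w ++_) (repeat-+ m n w))

run-repeat : ∀ {s} n w → run s w ≡ s → run s (repeat n w) ≡ s
run-repeat {s} zero    w e = refl
run-repeat {s} (suc n) w e = trans (run-++ s w (repeat n w)) (trans (cong (λ t → run t (repeat n w)) e) (run-repeat n w e))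

at-repeat-suc : ∀ n w q → q < n * length w → at (repeat (suc n) w) q ≡ at (repeat n w) q
at-repeat-suc (suc n) w q q<ℓ with q <? length w
... | yes q<m = trans (at-++ˡ w _ q q<m) (sym (at-++ˡ w _ q q<m))
... | no  q≮m = begin
  at (w ++ repeat (suc n) w) q  ≡⟨ at-++-≥ w _ q m≤q ⟩
  at (repeat (suc n) w) (q ∸ m) ≡⟨ at-repeat-suc n w (q ∸ m) q-m<nm ⟩
  at (repeat n w) (q ∸ m)       ≡⟨ sym (at-++-≥ w _ q m≤q) ⟩
  at (w ++ repeat n w) q        ∎
  where
  open ≡-Reasoning
  m = length w
  m≤q : m ≤ q
  m≤q = ≮⇒≥ q≮m
  q-m<nm : q ∸ m < n * m
  q-m<nm = +-cancelˡ-< m _ _ (subst (_< m + n * m) (sym (m+[n∸m]≡n m≤q)) q<ℓ)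

at-repeat-period : ∀ n w q → q + length w < n * length w → at (repeat n w) (q + length w) ≡ at (repeat n w) q
at-repeat-period (suc n) w q q+m<ℓ = begin
  at (w ++ repeat n w) (q + m) ≡⟨ at-++-≥ w _ (q + m) (m≤n+m m q) ⟩
  at (repeat n w) (q + m ∸ m)  ≡⟨ cong (at (repeat n w)) (m+n∸n≡m q m) ⟩
  at (repeat n w) q            ≡⟨ sym (at-repeat-suc n w q q<nm) ⟩
  at (w ++ repeat n w) q       ∎
  where
  open ≡-Reasoning
  m = length w
  q<nm : q < n * m
  q<nm = +-cancelʳ-< m q (n * m) (subst (q + m <_) (+-comm m (n * m)) q+m<ℓ)

at-repeat-periods : ∀ n w k q → q + k * length w < n * length w →
                    at (repeat n w) (q + k * length w) ≡ at (repeat n w) q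
at-repeat-periods n w zero    q _ = cong (at (repeat n w)) (+-identityʳ q)
at-repeat-periods n w (suc k) q l = begin
  at (repeat n w) (q + (m + k * m)) ≡⟨ cong (at (repeat n w)) q+[m+km]≡q+km+m ⟩
  at (repeat n w) (q + k * m + m)   ≡⟨ at-repeat-period n w (q + k * m) l′ ⟩
  at (repeat n w) (q + k * m)       ≡⟨ at-repeat-periods n w k q (≤-<-trans (m≤m+n (q + k * m) m) l′) ⟩
  at (repeat n w) q                 ∎
  where
  open ≡-Reasoning
  m = length w
  q+[m+km]≡q+km+m : q + (m + k * m) ≡ q + k * m + m
  q+[m+km]≡q+km+m = trans (cong (q +_) (+-comm m (k * m))) (sym (+-assoc q (k * m) m))
  l′ : q + k * m + m < n * m
  l′ = subst (_< n * m) q+[m+km]≡q+km+m l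

abⁿ : ℕ → Word
abⁿ zero    = []
abⁿ (suc n) = a ∷ b ∷ abⁿ n

length-abⁿ : ∀ n → length (abⁿ n) ≡ n + n
length-abⁿ zero    = refl
length-abⁿ (suc n) = cong suc (trans (cong suc (length-abⁿ n)) (sym (+-suc n n)))

run-abⁿ : ∀ {s} n → run s (a ∷ b ∷ []) ≡ s → run s (abⁿ n) ≡ s
run-abⁿ zero    _ = refl
run-abⁿ {s} (suc n) e = trans (cong (λ t → run t (abⁿ n)) e) (run-abⁿ n e)

-- u = C₀^(2K+1) lies in L. In v the middle block C₀ = Y a Z b becomes
-- C₁ = Y a Y b, whose second Y is read at depth 1 and so nests three deep:
-- v ∉ L. The words differ only at positions s + 1 and s + 2, and around
-- them v repeats the first Y of C₁, where v agrees with u.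
module WordPair (R K : ℕ) where
  abstract
    Y Z C₀ C₁ Prefix Suffix u v : Word
    Y      = abⁿ R ++ a ∷ a ∷ b ∷ b ∷ abⁿ R
    Z      = abⁿ R ++ a ∷ b ∷ a ∷ b ∷ abⁿ R
    C₀     = Y ++ a ∷ Z ++ b ∷ []
    C₁     = Y ++ a ∷ Y ++ b ∷ []
    Prefix = repeat K C₀ ++ Y ++ a ∷ abⁿ R
    Suffix = abⁿ R ++ b ∷ repeat K C₀
    u      = Prefix ++ a ∷ b ∷ a ∷ b ∷ Suffix
    v      = Prefix ++ a ∷ a ∷ b ∷ b ∷ Suffix

  m s ℓ : ℕ
  m = length C₀
  s = length Prefix
  ℓ = length u

  abstract
    middle-block : ∀ Q T → (Y ++ a ∷ abⁿ R) ++ Q ++ abⁿ R ++ b ∷ T ≡ (Y ++ a ∷ (abⁿ R ++ Q ++ abⁿ R) ++ b ∷ []) ++ T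
    middle-block Q T = begin
      (Y ++ a ∷ abⁿ R) ++ Q ++ abⁿ R ++ b ∷ T          ≡⟨ ++-assoc Y (a ∷ abⁿ R) _ ⟩
      Y ++ a ∷ abⁿ R ++ Q ++ abⁿ R ++ b ∷ T            ≡⟨ cong (λ x → Y ++ a ∷ x) (trans (++-assoc (abⁿ R ++ Q ++ abⁿ R) (b ∷ []) T)
                                                            (trans (++-assoc (abⁿ R) (Q ++ abⁿ R) (b ∷ T))
                                                                   (cong (abⁿ R ++_) (++-assoc Q (abⁿ R) (b ∷ T))))) ⟨
      Y ++ a ∷ ((abⁿ R ++ Q ++ abⁿ R) ++ b ∷ []) ++ T  ≡⟨ ++-assoc Y (a ∷ (abⁿ R ++ Q ++ abⁿ R) ++ b ∷ []) T ⟨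
      (Y ++ a ∷ (abⁿ R ++ Q ++ abⁿ R) ++ b ∷ []) ++ T  ∎
      where open ≡-Reasoning

    u≡C₀^K·C₀·C₀^K : u ≡ repeat K C₀ ++ C₀ ++ repeat K C₀
    u≡C₀^K·C₀·C₀^K = trans (++-assoc (repeat K C₀) (Y ++ a ∷ abⁿ R) _) (cong (repeat K C₀ ++_) (middle-block (a ∷ b ∷ a ∷ b ∷ []) (repeat K C₀)))

    v≡C₀^K·C₁·C₀^K : v ≡ repeat K C₀ ++ C₁ ++ repeat K C₀
    v≡C₀^K·C₁·C₀^K = trans (++-assoc (repeat K C₀) (Y ++ a ∷ abⁿ R) _) (cong (repeat K C₀ ++_) (middle-block (a ∷ a ∷ b ∷ b ∷ []) (repeat K C₀)))

    run-Y : run s0 Y ≡ s0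
    run-Y = run-++-≡ (abⁿ R) _ (run-abⁿ R refl) (run-abⁿ R refl)

    run-Y-nested : run s1 Y ≡ dead
    run-Y-nested = run-++-≡ (abⁿ R) _ (run-abⁿ R refl) (run-dead (b ∷ b ∷ abⁿ R))

    run-Z-nested : run s1 Z ≡ s1
    run-Z-nested = run-++-≡ (abⁿ R) _ (run-abⁿ R refl) (run-abⁿ R refl)

    run-C₀ : run s0 C₀ ≡ s0
    run-C₀ = run-++-≡ Y _ run-Y (run-++-≡ Z (b ∷ []) run-Z-nested refl)

    run-C₁ : run s0 C₁ ≡ dead
    run-C₁ = run-++-≡ Y _ run-Y (run-++-≡ Y (b ∷ []) run-Y-nested refl)

    run-u : run s0 u ≡ s0
    run-u = trans (cong (run s0) u≡C₀^K·C₀·C₀^K)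
              (run-++-≡ (repeat K C₀) _ (run-repeat K C₀ run-C₀) (run-++-≡ C₀ _ run-C₀ (run-repeat K C₀ run-C₀)))

    run-v : run s0 v ≡ dead
    run-v = trans (cong (run s0) v≡C₀^K·C₁·C₀^K)
              (run-++-≡ (repeat K C₀) _ (run-repeat K C₀ run-C₀) (run-++-≡ C₁ _ run-C₁ (run-dead (repeat K C₀))))

    agree-u-v : ∀ q → q ≢ suc s → q ≢ suc (suc s) → at u q ≡ at v q
    agree-u-v q q≢s+1 q≢s+2 with q <? s
    ... | yes q<s = trans (at-++ˡ Prefix _ q q<s) (sym (at-++ˡ Prefix _ q q<s))
    ... | no  q≮s = trans (at-++-≥ Prefix _ q s≤q) (trans (middle (q ∸ s) q-s≢1 q-s≢2) (sym (at-++-≥ Prefix _ q s≤q)))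
      where
      s≤q : s ≤ q
      s≤q = ≮⇒≥ q≮s
      q-s≢1 : q ∸ s ≢ 1
      q-s≢1 e = q≢s+1 (trans (sym (m+[n∸m]≡n s≤q)) (trans (cong (s +_) e) (+-comm s 1)))
      q-s≢2 : q ∸ s ≢ 2
      q-s≢2 e = q≢s+2 (trans (sym (m+[n∸m]≡n s≤q)) (trans (cong (s +_) e) (+-comm s 2)))
      middle : ∀ r → r ≢ 1 → r ≢ 2 → at (a ∷ b ∷ a ∷ b ∷ Suffix) r ≡ at (a ∷ a ∷ b ∷ b ∷ Suffix) r
      middle 0               _   _   = refl
      middle 1               r≢1 _   = ⊥-elim (r≢1 refl)
      middle 2               _   r≢2 = ⊥-elim (r≢2 refl)
      middle (suc (suc (suc r))) _ _ = refl

    length-Y : length Y ≡ 4 + (R + R + (R + R))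
    length-Y = trans (length-++ (abⁿ R) _) (trans (cong₂ (λ x y → x + (4 + y)) (length-abⁿ R) (length-abⁿ R)) ([2R]+[4+2R]≡4+4R R))
      where
      [2R]+[4+2R]≡4+4R : ∀ R → R + R + (4 + (R + R)) ≡ 4 + (R + R + (R + R))
      [2R]+[4+2R]≡4+4R = solve-∀

    length-C₀ : m ≡ length Y + suc (length Y + 1)
    length-C₀ = trans (length-++ Y _) (cong (λ z → length Y + suc z) (trans (length-++ Z (b ∷ [])) (cong (_+ 1) length-Z≡length-Y)))
      where
      length-Z≡length-Y : length Z ≡ length Y
      length-Z≡length-Y = trans (length-++ (abⁿ R) _) (sym (length-++ (abⁿ R) _))

    length-u : ℓ ≡ K * m + (m + K * m)
    length-u = trans (cong length u≡C₀^K·C₀·C₀^K) (trans (length-++ (repeat K C₀) _) (cong₂ _+_ (length-repeat K C₀) (trans (length-++ C₀ _) (cong (m +_) (length-repeat K C₀)))))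

    length-v : length v ≡ ℓ
    length-v = trans (length-++ Prefix _) (sym (length-++ Prefix _))

    length-Prefix : s ≡ K * m + (length Y + suc (R + R))
    length-Prefix = trans (length-++ (repeat K C₀) _) (cong₂ _+_ (length-repeat K C₀) (trans (length-++ Y _) (cong (λ z → length Y + suc z) (length-abⁿ R))))

  -- The two copies of Y in C₁ inside v.
  y₁ y₂ : ℕ
  y₁ = K * m
  y₂ = K * m + (length Y + 1)

  abstract
    v-repeats-Y : ∀ κ → κ < length Y → at v (y₂ + κ) ≡ at v (y₁ + κ)
    v-repeats-Y κ κ<Y = begin
      at v (y₂ + κ)                 ≡⟨ cong (at v) (trans (+-assoc y₁ (length Y + 1) κ) (cong (y₁ +_) (+-assoc (length Y) 1 κ))) ⟩
      at v (y₁ + (length Y + suc κ)) ≡⟨ at-v-C₁ (length Y + suc κ) second-in-C₁ ⟩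
      at C₁ (length Y + suc κ)       ≡⟨ at-++ʳ Y (a ∷ Y ++ b ∷ []) (suc κ) ⟩
      at (Y ++ b ∷ []) κ             ≡⟨ at-++ˡ Y (b ∷ []) κ κ<Y ⟩
      at Y κ                         ≡⟨ at-++ˡ Y _ κ κ<Y ⟨
      at C₁ κ                        ≡⟨ at-v-C₁ κ first-in-C₁ ⟨
      at v (y₁ + κ)                  ∎
      where
      open ≡-Reasoning
      at-v-C₁ : ∀ i → i < length C₁ → at v (y₁ + i) ≡ at C₁ i
      at-v-C₁ i i<C₁ = begin
        at v (y₁ + i)                                           ≡⟨ cong (λ z → at z (y₁ + i)) v≡C₀^K·C₁·C₀^K ⟩
        at (repeat K C₀ ++ C₁ ++ repeat K C₀) (y₁ + i)          ≡⟨ cong (λ z → at (repeat K C₀ ++ C₁ ++ repeat K C₀) (z + i)) (length-repeat K C₀) ⟨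
        at (repeat K C₀ ++ C₁ ++ repeat K C₀) (length (repeat K C₀) + i) ≡⟨ at-++ʳ (repeat K C₀) _ i ⟩
        at (C₁ ++ repeat K C₀) i                                ≡⟨ at-++ˡ C₁ (repeat K C₀) i i<C₁ ⟩
        at C₁ i                                                 ∎
      second-in-C₁ : length Y + suc κ < length C₁
      second-in-C₁ = subst (length Y + suc κ <_) (sym (length-++ Y _))
                       (+-monoʳ-< (length Y) (s≤s (subst (κ <_) (sym (length-++ Y (b ∷ []))) (≤-trans κ<Y (m≤m+n _ 1)))))
      first-in-C₁ : κ < length C₁
      first-in-C₁ = subst (κ <_) (sym (length-++ Y _)) (≤-trans κ<Y (m≤m+n _ _))

    u-periodic : ∀ n q → q + n * m < ℓ → at u (q + n * m) ≡ at u q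
    u-periodic n q l = begin
      at u (q + n * m)                      ≡⟨ cong (λ z → at z (q + n * m)) u≡C₀^[2K+1] ⟩
      at (repeat (K + suc K) C₀) (q + n * m) ≡⟨ at-repeat-periods (K + suc K) C₀ n q (subst (q + n * m <_) ℓ≡[2K+1]m l) ⟩
      at (repeat (K + suc K) C₀) q          ≡⟨ cong (λ z → at z q) u≡C₀^[2K+1] ⟨
      at u q                                ∎
      where
      open ≡-Reasoning
      u≡C₀^[2K+1] : u ≡ repeat (K + suc K) C₀
      u≡C₀^[2K+1] = trans u≡C₀^K·C₀·C₀^K (repeat-+ K (suc K) C₀)
      ℓ≡[2K+1]m : ℓ ≡ (K + suc K) * m
      ℓ≡[2K+1]m = trans (cong length u≡C₀^[2K+1]) (length-repeat (K + suc K) C₀)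

    u-dense : Dense u
    u-dense = live⇒dense u (after≢dead b ∘ trans (sym (trans (stateFrom-length s0 u) run-u)))

-- Duplicator's strategy

-- w around p and w′ around p′ agree up to distance r. Left of 0 the
-- truncated p ∸ t stays at 0, which only makes the condition stronger.
record Window (r : ℕ) (w : Word) (p : ℕ) (w′ : Word) (p′ : ℕ) : Set where
  constructor window
  field
    within : ∀ t → t ≤ r → at w (p + t) ≡ at w′ (p′ + t) × at w (p ∸ t) ≡ at w′ (p′ ∸ t)

module _ {r : ℕ} {w : Word} {p : ℕ} {w′ : Word} {p′ : ℕ} where
  Window-sym : Window r w p w′ p′ → Window r w′ p′ w p
  Window-sym (window W) = window λ t t≤r → sym (proj₁ (W t t≤r)) , sym (proj₂ (W t t≤r))

  Window-trans : ∀ {w″ p″} → Window r w p w′ p′ → Window r w′ p′ w″ p″ → Window r w p w″ p″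
  Window-trans (window W) (window W′) = window λ t t≤r → trans (proj₁ (W t t≤r)) (proj₁ (W′ t t≤r)) , trans (proj₂ (W t t≤r)) (proj₂ (W′ t t≤r))

  Window-mono : ∀ {r′} → r′ ≤ r → Window r w p w′ p′ → Window r′ w p w′ p′
  Window-mono r′≤r (window W) = window λ t t≤r′ → W t (≤-trans t≤r′ r′≤r)

[p+t]∸t′≡p∸[t′∸t] : ∀ p t t′ → t ≤ t′ → p + t ∸ t′ ≡ p ∸ (t′ ∸ t)
[p+t]∸t′≡p∸[t′∸t] p t t′ t≤t′ = trans (cong₂ _∸_ (+-comm p t) (sym (m+[n∸m]≡n t≤t′))) ([m+n]∸[m+o]≡n∸o t p (t′ ∸ t))

[p∸t]+t′≡p∸[t∸t′] : ∀ p t t′ → t ≤ p → t′ ≤ t → p ∸ t + t′ ≡ p ∸ (t ∸ t′)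
[p∸t]+t′≡p∸[t∸t′] p t t′ t≤p t′≤t = trans (sym (+-∸-comm t′ t≤p)) ([p+t]∸t′≡p∸[t′∸t] p t′ t t′≤t)

[p∸t]+t′≡p+[t′∸t] : ∀ p t t′ → t ≤ p → t ≤ t′ → p ∸ t + t′ ≡ p + (t′ ∸ t)
[p∸t]+t′≡p+[t′∸t] p t t′ t≤p t≤t′ = begin
  p ∸ t + t′             ≡⟨ cong (p ∸ t +_) (m+[n∸m]≡n t≤t′) ⟨
  p ∸ t + (t + (t′ ∸ t)) ≡⟨ +-assoc (p ∸ t) t (t′ ∸ t) ⟨
  p ∸ t + t + (t′ ∸ t)   ≡⟨ cong (_+ (t′ ∸ t)) (m∸n+n≡m t≤p) ⟩
  p + (t′ ∸ t)           ∎
  where open ≡-Reasoning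

Window-shiftʳ : ∀ {r₁ r₂ w p w′ p′} t → t + r₂ ≤ r₁ → Window r₁ w p w′ p′ → Window r₂ w (p + t) w′ (p′ + t)
Window-shiftʳ {r₁} {r₂} {w} {p} {w′} {p′} t t+r₂≤r₁ (window W) = window shifted
  where
  shifted : ∀ t′ → t′ ≤ r₂ → at w (p + t + t′) ≡ at w′ (p′ + t + t′) × at w (p + t ∸ t′) ≡ at w′ (p′ + t ∸ t′)
  shifted t′ t′≤r₂ = right , left
    where
    right : at w (p + t + t′) ≡ at w′ (p′ + t + t′)
    right = trans (cong (at w) (+-assoc p t t′)) (trans (proj₁ (W (t + t′) (≤-trans (+-monoʳ-≤ t t′≤r₂) t+r₂≤r₁))) (cong (at w′) (sym (+-assoc p′ t t′))))
    left : at w (p + t ∸ t′) ≡ at w′ (p′ + t ∸ t′)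
    left with t′ ≤? t
    ... | yes t′≤t = trans (cong (at w) (+-∸-assoc p t′≤t))
                       (trans (proj₁ (W (t ∸ t′) (≤-trans (m∸n≤m t t′) (≤-trans (m≤m+n t r₂) t+r₂≤r₁)))) (cong (at w′) (sym (+-∸-assoc p′ t′≤t))))
    ... | no t′≰t = trans (cong (at w) ([p+t]∸t′≡p∸[t′∸t] p t t′ t≤t′))
                      (trans (proj₂ (W (t′ ∸ t) (≤-trans (m∸n≤m t′ t) (≤-trans t′≤r₂ (≤-trans (m≤n+m r₂ t) t+r₂≤r₁)))))
                             (cong (at w′) (sym ([p+t]∸t′≡p∸[t′∸t] p′ t t′ t≤t′))))
      where t≤t′ = <⇒≤ (≰⇒> t′≰t)

Window-shiftˡ : ∀ {r₁ r₂ w p w′ p′} t → t + r₂ ≤ r₁ → t ≤ p → t ≤ p′ → Window r₁ w p w′ p′ → Window r₂ w (p ∸ t) w′ (p′ ∸ t)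
Window-shiftˡ {r₁} {r₂} {w} {p} {w′} {p′} t t+r₂≤r₁ t≤p t≤p′ (window W) = window shifted
  where
  shifted : ∀ t′ → t′ ≤ r₂ → at w (p ∸ t + t′) ≡ at w′ (p′ ∸ t + t′) × at w (p ∸ t ∸ t′) ≡ at w′ (p′ ∸ t ∸ t′)
  shifted t′ t′≤r₂ = right , left
    where
    left : at w (p ∸ t ∸ t′) ≡ at w′ (p′ ∸ t ∸ t′)
    left = trans (cong (at w) (∸-+-assoc p t t′)) (trans (proj₂ (W (t + t′) (≤-trans (+-monoʳ-≤ t t′≤r₂) t+r₂≤r₁))) (cong (at w′) (sym (∸-+-assoc p′ t t′))))
    right : at w (p ∸ t + t′) ≡ at w′ (p′ ∸ t + t′)
    right with t′ ≤? t
    ... | yes t′≤t = trans (cong (at w) ([p∸t]+t′≡p∸[t∸t′] p t t′ t≤p t′≤t))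
                       (trans (proj₂ (W (t ∸ t′) (≤-trans (m∸n≤m t t′) (≤-trans (m≤m+n t r₂) t+r₂≤r₁))))
                              (cong (at w′) (sym ([p∸t]+t′≡p∸[t∸t′] p′ t t′ t≤p′ t′≤t))))
    ... | no t′≰t = trans (cong (at w) ([p∸t]+t′≡p+[t′∸t] p t t′ t≤p t≤t′))
                      (trans (proj₁ (W (t′ ∸ t) (≤-trans (m∸n≤m t′ t) (≤-trans t′≤r₂ (≤-trans (m≤n+m r₂ t) t+r₂≤r₁)))))
                             (cong (at w′) (sym ([p∸t]+t′≡p+[t′∸t] p′ t t′ t≤p′ t≤t′))))
      where t≤t′ = <⇒≤ (≰⇒> t′≰t)

Window-from-factor : ∀ {w w′ x x′ n} r κ → (∀ κ → κ < n → at w (x + κ) ≡ at w′ (x′ + κ)) →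
                     r ≤ κ → κ + r < n → Window r w (x + κ) w′ (x′ + κ)
Window-from-factor {w} {w′} {x} {x′} r κ same r≤κ κ+r<n = window from-factor
  where
  from-factor : ∀ t → t ≤ r → at w (x + κ + t) ≡ at w′ (x′ + κ + t) × at w (x + κ ∸ t) ≡ at w′ (x′ + κ ∸ t)
  from-factor t t≤r =
    trans (cong (at w) (+-assoc x κ t)) (trans (same (κ + t) (≤-<-trans (+-monoʳ-≤ κ t≤r) κ+r<n)) (cong (at w′) (sym (+-assoc x′ κ t)))) ,
    trans (cong (at w) (+-∸-assoc x t≤κ)) (trans (same (κ ∸ t) (≤-<-trans (m∸n≤m κ t) (≤-<-trans (m≤m+n κ r) κ+r<n))) (cong (at w′) (sym (+-∸-assoc x′ t≤κ))))
    where t≤κ = ≤-trans t≤r r≤κ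

Window-outside : ∀ {w w′} s → (∀ q → q ≢ suc s → q ≢ suc (suc s) → at w q ≡ at w′ q) →
                 ∀ r p → p + r ≤ s ⊎ 3 + s + r ≤ p → Window r w p w′ p
Window-outside s agree r p away = window λ t t≤r →
  agree (p + t) (≢s+1 (right t≤r away)) (≢s+2 (right t≤r away)) , agree (p ∸ t) (≢s+1 (left t≤r away)) (≢s+2 (left t≤r away))
  where
  Clear : ℕ → Set
  Clear q = q ≤ s ⊎ 3 + s ≤ q
  ≢s+1 : ∀ {q} → Clear q → q ≢ suc s
  ≢s+1 (inj₁ q≤s)   refl = <-irrefl refl q≤s
  ≢s+1 (inj₂ 3+s≤q) refl = <-irrefl refl (≤-trans (s≤s (n≤1+n _)) 3+s≤q)
  ≢s+2 : ∀ {q} → Clear q → q ≢ suc (suc s)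
  ≢s+2 (inj₁ q≤s)   refl = <-irrefl refl (≤-trans (n≤1+n _) q≤s)
  ≢s+2 (inj₂ 3+s≤q) refl = <-irrefl refl 3+s≤q
  right : ∀ {t} → t ≤ r → p + r ≤ s ⊎ 3 + s + r ≤ p → Clear (p + t)
  right t≤r (inj₁ p+r≤s)       = inj₁ (≤-trans (+-monoʳ-≤ p t≤r) p+r≤s)
  right {t} t≤r (inj₂ 3+s+r≤p) = inj₂ (≤-trans (≤-trans (m≤m+n (3 + s) _) 3+s+r≤p) (m≤m+n p t))
  left : ∀ {t} → t ≤ r → p + r ≤ s ⊎ 3 + s + r ≤ p → Clear (p ∸ t)
  left {t} t≤r (inj₁ p+r≤s)    = inj₁ (≤-trans (m∸n≤m p t) (≤-trans (m≤m+n p r) p+r≤s))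
  left {t} t≤r (inj₂ 3+s+r≤p) = inj₂ (≤-trans (≤-reflexive (sym (m+n∸n≡m (3 + s) t))) (∸-monoˡ-≤ t (≤-trans (+-monoʳ-≤ (3 + s) t≤r) 3+s+r≤p)))

-- With j rounds left, matched positions have equal windows of radius
-- radius j, and deep positions keep margin j = blocks j · m to both ends.
radius : ℕ → ℕ
radius zero = 4
radius (suc j) = 4 + radius j

blocks : ℕ → ℕ
blocks zero = 2
blocks (suc j) = 2 + blocks j

radius-mono : ∀ j k → j ≤ k → radius j ≤ radius k
radius-mono zero zero _ = ≤-refl
radius-mono zero (suc k) _ = ≤-trans (radius-mono zero k z≤n) (m≤n+m (radius k) 4)
radius-mono (suc j) (suc k) (s≤s l) = +-monoʳ-≤ 4 (radius-mono j k l)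

4≤radius : ∀ j → 4 ≤ radius j
4≤radius zero = ≤-refl
4≤radius (suc j) = m≤m+n 4 (radius j)

blocks-mono : ∀ j k → j ≤ k → blocks j ≤ blocks k
blocks-mono zero zero _ = ≤-refl
blocks-mono zero (suc k) _ = ≤-trans (blocks-mono zero k z≤n) (m≤n+m (blocks k) 2)
blocks-mono (suc j) (suc k) (s≤s l) = +-monoʳ-≤ 2 (blocks-mono j k l)

2≤blocks : ∀ j → 2 ≤ blocks j
2≤blocks zero = ≤-refl
2≤blocks (suc j) = m≤m+n 2 (blocks j)

module Construction (k : ℕ) where
  R K : ℕ
  R = radius k
  K = blocks k + 3
  open WordPair R K public

  margin : ℕ → ℕ
  margin j = blocks j * m

  Eₖ : ℕ
  Eₖ = margin k

  [x+3]m≡xm+3m : ∀ x m → (x + 3) * m ≡ x * m + (m + (m + m))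
  [x+3]m≡xm+3m = solve-∀

  Km≡Eₖ+3m : K * m ≡ Eₖ + (m + (m + m))
  Km≡Eₖ+3m = [x+3]m≡xm+3m (blocks k) m

  m≡10+8R : m ≡ 10 + (R + R + (R + R) + (R + R + (R + R)))
  m≡10+8R = trans length-C₀ (trans (cong (λ y → y + suc (y + 1)) length-Y) (rearrange R))
    where
    rearrange : ∀ R → 4 + (R + R + (R + R)) + suc (4 + (R + R + (R + R)) + 1) ≡ 10 + (R + R + (R + R) + (R + R + (R + R)))
    rearrange = solve-∀

  instance
    m-nonZero : NonZero m
    m-nonZero = >-nonZero (subst (0 <_) (sym m≡10+8R) (s≤s z≤n))

  s-split : s ≡ Eₖ + (m + (m + m)) + (4 + (R + R + (R + R)) + suc (R + R))
  s-split = trans length-Prefix (cong₂ _+_ Km≡Eₖ+3m (cong (_+ suc (R + R)) length-Y))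

  ℓ-split : ℓ ≡ s + (Eₖ + (m + (m + m)) + (R + R + 5))
  ℓ-split = begin
    ℓ                                   ≡⟨ length-u ⟩
    K * m + (m + K * m)                 ≡⟨ subst (λ z → K * z + (z + K * z) ≡ rhs z) (sym m≡10+8R) (rearrange (blocks k) R) ⟩
    rhs m                               ≡⟨ cong (_+ (Eₖ + (m + (m + m)) + (R + R + 5))) s-split ⟨
    s + (Eₖ + (m + (m + m)) + (R + R + 5)) ∎
    where
    open ≡-Reasoning
    rhs : ℕ → ℕ
    rhs z = blocks k * z + (z + (z + z)) + (4 + (R + R + (R + R)) + suc (R + R)) + (blocks k * z + (z + (z + z)) + (R + R + 5))
    rearrange : ∀ x R → let z = 10 + (R + R + (R + R) + (R + R + (R + R))) in
                (x + 3) * z + (z + (x + 3) * z)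
                ≡ x * z + (z + (z + z)) + (4 + (R + R + (R + R)) + suc (R + R)) + (x * z + (z + (z + z)) + (R + R + 5))
    rearrange = solve-∀

  R+10≤m : R + 10 ≤ m
  R+10≤m = subst (R + 10 ≤_) (sym m≡10+8R) (subst (_≤ 10 + (R + R + (R + R) + (R + R + (R + R)))) (+-comm 10 R)
             (+-monoʳ-≤ 10 (≤-trans (m≤m+n R R) (≤-trans (m≤m+n (R + R) (R + R)) (m≤m+n _ _)))))

  5+R≤m : 5 + R ≤ m
  5+R≤m = ≤-trans (≤-reflexive (+-comm 5 R)) (≤-trans (+-monoʳ-≤ R (m≤m+n 5 5)) R+10≤m)

  4≤m : 4 ≤ m
  4≤m = ≤-trans (m≤m+n 4 (1 + R)) 5+R≤m

  radius≤R : ∀ j → j ≤ k → radius j ≤ R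
  radius≤R j j≤k = radius-mono j k j≤k

  margin-mono : ∀ j → j ≤ k → margin j ≤ Eₖ
  margin-mono j j≤k = *-monoˡ-≤ m (blocks-mono j k j≤k)

  R≤margin : ∀ j → R ≤ margin j
  R≤margin j = ≤-trans (≤-trans (m≤m+n R 10) R+10≤m) (≤-trans (m≤m+n m m) 2m≤margin)
    where
    2m≤margin : m + m ≤ margin j
    2m≤margin = subst (_≤ margin j) (cong (m +_) (+-identityʳ m)) (*-monoˡ-≤ m (2≤blocks j))

  margin-suc : ∀ j t → t ≤ 4 → t + margin j ≤ margin (suc j)
  margin-suc j t t≤4 = subst (t + margin j ≤_) (+-assoc m m (margin j)) (+-monoˡ-≤ (margin j) (≤-trans t≤4 (≤-trans 4≤m (m≤m+n m m))))

  margin≤margin-suc : ∀ j → margin j ≤ margin (suc j)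
  margin≤margin-suc j = margin-suc j 0 z≤n

  margin+m+4≤margin-suc : ∀ j → margin j + m + 4 ≤ margin (suc j)
  margin+m+4≤margin-suc j = ≤-trans (+-monoʳ-≤ (margin j + m) 4≤m) (≤-reflexive (rearrange (margin j) m))
    where
    rearrange : ∀ e m → e + m + m ≡ m + (m + e)
    rearrange = solve-∀

  s+R<ℓ : s + R < ℓ
  s+R<ℓ = subst (s + R <_) (sym ℓ-split) (+-monoʳ-< s (≤-trans R<2R+5 (m≤n+m (R + R + 5) (Eₖ + (m + (m + m))))))
    where
    R<2R+5 : R < R + R + 5
    R<2R+5 = ≤-trans (s≤s (m≤m+n R R)) (≤-trans (≤-reflexive (+-comm 1 (R + R))) (+-monoʳ-≤ (R + R) (s≤s z≤n)))

  s+Eₖ≤ℓ : s + Eₖ ≤ ℓ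
  s+Eₖ≤ℓ = subst (s + Eₖ ≤_) (sym ℓ-split) (+-monoʳ-≤ s (≤-trans (m≤m+n Eₖ _) (m≤m+n _ _)))

  left-of-swap : ∀ j → j ≤ k → ∀ i → i ≤ margin j + m + 4 → i + R ≤ s
  left-of-swap j j≤k i i≤ = begin
    i + R                 ≤⟨ +-monoˡ-≤ R i≤ ⟩
    margin j + m + 4 + R  ≤⟨ +-monoˡ-≤ R (+-monoˡ-≤ 4 (+-monoˡ-≤ m (margin-mono j j≤k))) ⟩
    Eₖ + m + 4 + R        ≡⟨ rearrange Eₖ m R ⟩
    Eₖ + (m + (4 + R))    ≤⟨ +-monoʳ-≤ Eₖ (+-monoʳ-≤ m (≤-trans (n≤1+n _) (≤-trans 5+R≤m (m≤m+n m m)))) ⟩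
    Eₖ + (m + (m + m))    ≤⟨ subst (Eₖ + (m + (m + m)) ≤_) (sym s-split) (m≤m+n _ _) ⟩
    s                     ∎
    where
    open ≤-Reasoning
    rearrange : ∀ e m R → e + m + 4 + R ≡ e + (m + (4 + R))
    rearrange = solve-∀

  <margin⇒≤margin+m+4 : ∀ j {i} → i < margin j → i ≤ margin j + m + 4
  <margin⇒≤margin+m+4 j i<E = ≤-trans (<⇒≤ i<E) (≤-trans (m≤m+n (margin j) m) (m≤m+n _ 4))

  margin+m+R≤s : ∀ j → j ≤ k → margin j + m + R ≤ s
  margin+m+R≤s j j≤k = left-of-swap j j≤k (margin j + m) (m≤m+n _ 4)

  right-of-swap : ∀ j → j ≤ k → ∀ i → ℓ ≤ i + margin j → 3 + s + R ≤ i
  right-of-swap j j≤k i ℓ≤ = +-cancelʳ-≤ Eₖ (3 + s + R) i (begin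
    3 + s + R + Eₖ                          ≤⟨ subst (3 + s + R + Eₖ ≤_) (rearrange s R Eₖ m) (m≤m+n _ (m + (m + m) + R + 2)) ⟩
    s + (Eₖ + (m + (m + m)) + (R + R + 5))  ≡⟨ ℓ-split ⟨
    ℓ                                       ≤⟨ ℓ≤ ⟩
    i + margin j                            ≤⟨ +-monoʳ-≤ i (margin-mono j j≤k) ⟩
    i + Eₖ                                  ∎)
    where
    open ≤-Reasoning
    rearrange : ∀ s R e m → 3 + s + R + e + (m + (m + m) + R + 2) ≡ s + (e + (m + (m + m)) + (R + R + 5))
    rearrange = solve-∀

  farBlock : ℕ → ℕ
  farBlock j = K + (K ∸ blocks j)

  farBlock-end : ∀ j → j ≤ k → farBlock j * m + m + margin j ≡ ℓ
  farBlock-end j j≤k = begin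
    (K + d) * m + m + blocks j * m                       ≡⟨ cong (λ z → (z + d) * m + m + blocks j * m) K≡ ⟩
    (blocks j + d + d) * m + m + blocks j * m            ≡⟨ rearrange (blocks j) d m ⟩
    (blocks j + d) * m + (m + (blocks j + d) * m)        ≡⟨ cong (λ z → z * m + (m + z * m)) K≡ ⟨
    K * m + (m + K * m)                                  ≡⟨ length-u ⟨
    ℓ                                                    ∎
    where
    open ≡-Reasoning
    d = K ∸ blocks j
    K≡ : K ≡ blocks j + d
    K≡ = sym (m+[n∸m]≡n (≤-trans (blocks-mono j k j≤k) (m≤m+n (blocks k) 3)))
    rearrange : ∀ x d m → (x + d + d) * m + m + x * m ≡ (x + d) * m + (m + (x + d) * m)
    rearrange = solve-∀

  swap-left-of-farBlock : ∀ j → j ≤ k → 3 + s + R ≤ farBlock j * m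
  swap-left-of-farBlock j j≤k = +-cancelʳ-≤ (m + Eₖ) (3 + s + R) (farBlock j * m) (begin
    3 + s + R + (m + Eₖ)                     ≤⟨ subst (3 + s + R + (m + Eₖ) ≤_) (rearrange s R Eₖ m) (m≤m+n _ (m + m + R + 2)) ⟩
    s + (Eₖ + (m + (m + m)) + (R + R + 5))   ≡⟨ ℓ-split ⟨
    ℓ                                        ≡⟨ farBlock-end j j≤k ⟨
    farBlock j * m + m + margin j            ≡⟨ +-assoc (farBlock j * m) m (margin j) ⟩
    farBlock j * m + (m + margin j)          ≤⟨ +-monoʳ-≤ (farBlock j * m) (+-monoʳ-≤ m (margin-mono j j≤k)) ⟩
    farBlock j * m + (m + Eₖ)                ∎)
    where
    open ≤-Reasoning
    rearrange : ∀ s R e m → 3 + s + R + (m + e) + (m + m + R + 2) ≡ s + (e + (m + (m + m)) + (R + R + 5))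
    rearrange = solve-∀

  first-blocks-deep : ∀ j → j ≤ k → ∀ i → i < margin j + m → i + margin j < ℓ
  first-blocks-deep j j≤k i i< = begin-strict
    i + margin j      <⟨ +-monoˡ-< (margin j) i< ⟩
    margin j + m + margin j ≤⟨ +-monoˡ-≤ (margin j) (≤-trans (m≤m+n _ R) (margin+m+R≤s j j≤k)) ⟩
    s + margin j      ≤⟨ +-monoʳ-≤ s (margin-mono j j≤k) ⟩
    s + Eₖ            ≤⟨ s+Eₖ≤ℓ ⟩
    ℓ                 ∎
    where open ≤-Reasoning

  Window-period : ∀ r p n → r ≤ p → p + r + n * m < ℓ → Window r u p u (p + n * m)
  Window-period r p n r≤p l = window λ t t≤r → sym (right t t≤r) , sym (left t t≤r)
    where
    right : ∀ t → t ≤ r → at u (p + n * m + t) ≡ at u (p + t)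
    right t t≤r = trans (cong (at u) (trans (+-assoc p (n * m) t) (trans (cong (p +_) (+-comm (n * m) t)) (sym (+-assoc p t (n * m))))))
                  (u-periodic n (p + t) (≤-<-trans (+-monoˡ-≤ (n * m) (+-monoʳ-≤ p t≤r)) l))
    left : ∀ t → t ≤ r → at u (p + n * m ∸ t) ≡ at u (p ∸ t)
    left t t≤r = trans (cong (at u) (+-∸-comm (n * m) (≤-trans t≤r r≤p)))
                 (u-periodic n (p ∸ t) (≤-<-trans (+-monoˡ-≤ (n * m) (≤-trans (m∸n≤m p t) (m≤m+n p r))) l))

  Window-align : ∀ r i β → r ≤ i → r ≤ β * m → i + r < ℓ → β * m + m + r ≤ ℓ → Window r u i u (β * m + i % m)
  Window-align r i β r≤i r≤βm i+r<ℓ βm+m+r≤ℓ with i / m ≤? β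
  ... | yes q≤β = subst (Window r u i u) i+dm≡ (Window-period r i d r≤i bound)
    where
    d = β ∸ i / m
    i+dm≡ : i + d * m ≡ β * m + i % m
    i+dm≡ = begin
      i + d * m                        ≡⟨ cong (_+ d * m) (m≡m%n+[m/n]*n i m) ⟩
      i % m + i / m * m + d * m        ≡⟨ rearrange (i % m) (i / m) d m ⟩
      (i / m + d) * m + i % m          ≡⟨ cong (λ z → z * m + i % m) (m+[n∸m]≡n q≤β) ⟩
      β * m + i % m                    ∎
      where
      open ≡-Reasoning
      rearrange : ∀ ρ q d m → ρ + q * m + d * m ≡ (q + d) * m + ρ
      rearrange = solve-∀
    bound : i + r + d * m < ℓ
    bound = subst (_< ℓ) (trans (cong (_+ r) (sym i+dm≡)) (trans (+-assoc i (d * m) r) (trans (cong (i +_) (+-comm (d * m) r)) (sym (+-assoc i r (d * m))))))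
              (≤-trans (+-monoˡ-≤ r (+-monoʳ-< (β * m) (m%n<n i m))) βm+m+r≤ℓ)
  ... | no q≰β = Window-sym (subst (Window r u (β * m + i % m) u) (sym i≡) (Window-period r (β * m + i % m) d (≤-trans r≤βm (m≤m+n _ _)) bound))
    where
    d = i / m ∸ β
    i≡ : i ≡ β * m + i % m + d * m
    i≡ = begin
      i                                ≡⟨ m≡m%n+[m/n]*n i m ⟩
      i % m + i / m * m                ≡⟨ cong (λ z → i % m + z * m) (m+[n∸m]≡n (<⇒≤ (≰⇒> q≰β))) ⟨
      i % m + (β + d) * m              ≡⟨ rearrange (i % m) β d m ⟩
      β * m + i % m + d * m            ∎
      where
      open ≡-Reasoning
      rearrange : ∀ ρ β d m → ρ + (β + d) * m ≡ β * m + ρ + d * m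
      rearrange = solve-∀
    bound : β * m + i % m + r + d * m < ℓ
    bound = subst (_< ℓ) (trans (cong (_+ r) i≡) (trans (+-assoc (β * m + i % m) (d * m) r)
              (trans (cong (β * m + i % m +_) (+-comm (d * m) r)) (sym (+-assoc (β * m + i % m) r (d * m)))))) i+r<ℓ

  agree-v-u : ∀ q → q ≢ suc s → q ≢ suc (suc s) → at v q ≡ at u q
  agree-v-u q q≢s+1 q≢s+2 = sym (agree-u-v q q≢s+1 q≢s+2)

  Deep : ℕ → ℕ → Set
  Deep j p = margin j ≤ p × p + margin j < ℓ

  SeenInU : Word → Set
  SeenInU w = ∀ j → j ≤ k → ∀ i → Deep j i → ∃ λ i₀ → Window (radius j) w i u i₀ × R ≤ i₀ × i₀ + R < ℓ

  Deep⇒room : ∀ j i → Deep j i → R ≤ i × i + R < ℓ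
  Deep⇒room j i (E≤i , i+E<ℓ) = ≤-trans (R≤margin j) E≤i , ≤-<-trans (+-monoʳ-≤ i (R≤margin j)) i+E<ℓ

  u-SeenInU : SeenInU u
  u-SeenInU j _ i deep = i , window (λ _ _ → refl , refl) , Deep⇒room j i deep

  s≡y₂+2R : s ≡ y₂ + (R + R)
  s≡y₂+2R = trans length-Prefix (rearrange (K * m) (length Y) R)
    where
    rearrange : ∀ x y R → x + (y + suc (R + R)) ≡ x + (y + 1) + (R + R)
    rearrange = solve-∀

  near-swap-in-Y : ∀ {i r} → r ≤ R → s < i + r → i < 3 + s + r → ∃ λ κ → i ≡ y₂ + κ × r ≤ κ × κ + r < length Y
  near-swap-in-Y {i} {r} r≤R s<i+r i<3+s+r = κ , i≡y₂+κ , ≤-trans r≤R (<⇒≤ R<κ) , κ+r<Y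
    where
    y₂+R<i : y₂ + R < i
    y₂+R<i = +-cancelʳ-< R (y₂ + R) i (subst (_< i + R) (trans s≡y₂+2R (sym (+-assoc y₂ R R))) (<-≤-trans s<i+r (+-monoʳ-≤ i r≤R)))
    κ = i ∸ y₂
    i≡y₂+κ : i ≡ y₂ + κ
    i≡y₂+κ = sym (m+[n∸m]≡n (≤-trans (m≤m+n y₂ R) (<⇒≤ y₂+R<i)))
    R<κ : R < κ
    R<κ = +-cancelˡ-< y₂ R κ (subst (y₂ + R <_) i≡y₂+κ y₂+R<i)
    κ<3+2R+r : κ < 3 + (R + R) + r
    κ<3+2R+r = +-cancelˡ-< y₂ κ _ (subst₂ _<_ i≡y₂+κ (trans (cong (λ z → 3 + z + r) s≡y₂+2R) (rearrange y₂ R r)) i<3+s+r)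
      where
      rearrange : ∀ y R r → 3 + (y + (R + R)) + r ≡ y + (3 + (R + R) + r)
      rearrange = solve-∀
    κ+r<Y : κ + r < length Y
    κ+r<Y = subst (κ + r <_) (sym length-Y) (begin
      suc κ + r                  ≤⟨ +-monoˡ-≤ r κ<3+2R+r ⟩
      3 + (R + R) + r + r        ≤⟨ +-mono-≤ (+-monoʳ-≤ (3 + (R + R)) r≤R) r≤R ⟩
      3 + (R + R) + R + R        ≡⟨ rearrange R ⟩
      3 + (R + R + (R + R))      <⟨ n<1+n _ ⟩
      4 + (R + R + (R + R))      ∎)
      where
      open ≤-Reasoning
      rearrange : ∀ R → 3 + (R + R) + R + R ≡ 3 + (R + R + (R + R))
      rearrange = solve-∀

  -- Near the swap, v looks like the first Y of C₁, which lies left of the swap.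
  v-SeenInU : SeenInU v
  v-SeenInU j j≤k i deep with i + radius j ≤? s | 3 + s + radius j ≤? i
  ... | yes left | _ = i , Window-outside s agree-v-u (radius j) i (inj₁ left) , Deep⇒room j i deep
  ... | no _ | yes right = i , Window-outside s agree-v-u (radius j) i (inj₂ right) , Deep⇒room j i deep
  ... | no ¬left | no ¬right with near-swap-in-Y (radius≤R j j≤k) (≰⇒> ¬left) (≰⇒> ¬right)
  ...   | κ , refl , r≤κ , κ+r<Y = y₁ + κ , Window-trans (Window-from-factor (radius j) κ v-repeats-Y r≤κ κ+r<Y) copy-agrees , R≤y₁+κ , y₁+κ+R<ℓ
    where
    r = radius j
    y₁+κ+r≤s : y₁ + κ + r ≤ s
    y₁+κ+r≤s = subst (y₁ + κ + r ≤_) (sym length-Prefix)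
                 (≤-trans (≤-reflexive (+-assoc y₁ κ r)) (+-monoʳ-≤ y₁ (≤-trans (<⇒≤ κ+r<Y) (m≤m+n (length Y) _))))
    copy-agrees : Window r v (y₁ + κ) u (y₁ + κ)
    copy-agrees = Window-outside s agree-v-u r (y₁ + κ) (inj₁ y₁+κ+r≤s)
    R≤y₁+κ : R ≤ y₁ + κ
    R≤y₁+κ = ≤-trans (≤-trans (R≤margin k) (m≤m+n Eₖ _)) (≤-trans (≤-reflexive (sym Km≡Eₖ+3m)) (m≤m+n y₁ κ))
    y₁+κ+R<ℓ : y₁ + κ + R < ℓ
    y₁+κ+R<ℓ = ≤-<-trans (+-monoˡ-≤ R (≤-trans (m≤m+n (y₁ + κ) r) y₁+κ+r≤s)) s+R<ℓ

  SameOrDeep : ℕ → ℕ → ℕ → Set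
  SameOrDeep j p p′ = p ≡ p′ ⊎ Deep j p × Deep j p′

  SameOrDeep-sym : ∀ {j p p′} → SameOrDeep j p p′ → SameOrDeep j p′ p
  SameOrDeep-sym (inj₁ e)          = inj₁ (sym e)
  SameOrDeep-sym (inj₂ (dp , dp′)) = inj₂ (dp′ , dp)

  Deep-weaken : ∀ j {p} → Deep (suc j) p → Deep j p
  Deep-weaken j {p} (E≤p , p+E<ℓ) = ≤-trans (margin≤margin-suc j) E≤p , ≤-<-trans (+-monoʳ-≤ p (margin≤margin-suc j)) p+E<ℓ

  Deep-shiftʳ : ∀ j {p} t → t ≤ 4 → Deep (suc j) p → Deep j (p + t)
  Deep-shiftʳ j {p} t t≤4 (E≤p , p+E<ℓ) =
    ≤-trans (≤-trans (margin≤margin-suc j) E≤p) (m≤m+n p t) ,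
    ≤-<-trans (≤-trans (≤-reflexive (+-assoc p t (margin j))) (+-monoʳ-≤ p (margin-suc j t t≤4))) p+E<ℓ

  Deep-shiftˡ : ∀ j {p} t → t ≤ 4 → Deep (suc j) p → t ≤ p × Deep j (p ∸ t)
  Deep-shiftˡ j {p} t t≤4 (E≤p , p+E<ℓ) =
    ≤-trans (≤-trans (m≤m+n t (margin j)) (margin-suc j t t≤4)) E≤p ,
    subst (_≤ p ∸ t) (m+n∸m≡n t (margin j)) (∸-monoˡ-≤ t (≤-trans (margin-suc j t t≤4) E≤p)) ,
    ≤-<-trans (+-monoˡ-≤ (margin j) (m∸n≤m p t)) (≤-<-trans (+-monoʳ-≤ p (margin≤margin-suc j)) p+E<ℓ)

  deep-before-farBlock : ∀ j → j ≤ k → ∀ {p} → p + margin (suc j) < ℓ → p + m < farBlock j * m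
  deep-before-farBlock j j≤k {p} p+E<ℓ = +-cancelʳ-< (m + margin j) (p + m) (farBlock j * m)
    (subst₂ _<_ (rearrange p m (margin j)) (trans (sym (farBlock-end j j≤k)) (+-assoc (farBlock j * m) m (margin j))) p+E<ℓ)
    where
    rearrange : ∀ p m e → p + (m + (m + e)) ≡ p + m + (m + e)
    rearrange = solve-∀

  s≤ℓ : s ≤ ℓ
  s≤ℓ = subst (s ≤_) (sym ℓ-split) (m≤m+n s _)

  -- w₂ answers moves in w₁; w₁, w₂ is u, v or v, u.
  module Simulating (w₁ w₂ : Word) (ℓ₁ : length w₁ ≡ ℓ) (ℓ₂ : length w₂ ≡ ℓ)
    (agree : ∀ q → q ≢ suc s → q ≢ suc (suc s) → at w₁ q ≡ at w₂ q)
    (agree-u : ∀ q → q ≢ suc s → q ≢ suc (suc s) → at u q ≡ at w₂ q)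
    (dense : Dense w₁ ⊎ Dense w₂)
    (seen : SeenInU w₁) where

    Match : ℕ → ℕ → ℕ → Set
    Match j p p′ = j ≤ k × Window (radius j) w₁ p w₂ p′ × SameOrDeep j p p′

    copy-into-block : ∀ j → j ≤ k → ∀ i → Deep j i → ∀ β → R ≤ β * m → β * m + m + R ≤ ℓ →
                      β * m + m + R ≤ s ⊎ 3 + s + R ≤ β * m →
                      ∃ λ i′ → β * m ≤ i′ × i′ < β * m + m × Window (radius j) w₁ i w₂ i′
    copy-into-block j j≤k i deep β R≤βm βm+m+R≤ℓ away with seen j j≤k i deep
    ... | i₀ , W₀ , R≤i₀ , i₀+R<ℓ =
          β * m + i₀ % m , m≤m+n _ _ , +-monoʳ-< (β * m) (m%n<n i₀ m) ,
          Window-trans W₀ (Window-trans (Window-mono r≤R (Window-align R i₀ β R≤i₀ R≤βm i₀+R<ℓ βm+m+R≤ℓ))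
                                        (Window-outside s agree-u r (β * m + i₀ % m) (narrow away)))
      where
      r = radius j
      r≤R : r ≤ R
      r≤R = radius≤R j j≤k
      narrow : β * m + m + R ≤ s ⊎ 3 + s + R ≤ β * m → β * m + i₀ % m + r ≤ s ⊎ 3 + s + r ≤ β * m + i₀ % m
      narrow (inj₁ left)  = inj₁ (≤-trans (+-mono-≤ (<⇒≤ (+-monoʳ-< (β * m) (m%n<n i₀ m))) r≤R) left)
      narrow (inj₂ right) = inj₂ (≤-trans (+-monoʳ-≤ (3 + s) r≤R) (≤-trans right (m≤m+n _ _)))

    same-letter : ∀ {j p p′} → Match j p p′ → at w₁ p ≡ at w₂ p′
    same-letter {j} {p} {p′} (_ , W , _) = subst₂ (λ x y → at w₁ x ≡ at w₂ y) (+-identityʳ p) (+-identityʳ p′) (proj₁ (Window.within W 0 z≤n))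

    near-between : ∀ {j p p′} → Match j p p′ → ∀ t → t ≤ 4 → ∀ c → Between w₁ c p (p + t) → Between w₂ c p′ (p′ + t)
    near-between {j} {p} {p′} (_ , W , _) t t≤4 c (q , inj₁ (p<q , q<p+t) , e) = p′ + d , inj₁ (p′<p′+d , +-monoʳ-< p′ d<t) , e′
      where
      d = q ∸ p
      p+d≡q : p + d ≡ q
      p+d≡q = m+[n∸m]≡n (<⇒≤ p<q)
      d<t : d < t
      d<t = +-cancelˡ-< p d t (subst (_< p + t) (sym p+d≡q) q<p+t)
      p′<p′+d : p′ < p′ + d
      p′<p′+d = m<m+n p′ (+-cancelˡ-< p 0 d (subst₂ _<_ (sym (+-identityʳ p)) (sym p+d≡q) p<q))
      e′ : at w₂ (p′ + d) ≡ just c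
      e′ = trans (sym (proj₁ (Window.within W d (≤-trans (<⇒≤ d<t) (≤-trans t≤4 (4≤radius j)))))) (trans (cong (at w₁) p+d≡q) e)
    near-between {j} {p} {p′} _ t _ c (q , inj₂ (p+t<q , q<p) , _) = ⊥-elim (<-asym (≤-<-trans (m≤m+n p t) p+t<q) q<p)

    -- A factor of length 3 contains both letters, so every letter occurs
    -- between positions more than 4 apart.
    between-from-density : ∀ w x q d c → 0 < d → d ≤ 3 → x + 4 < q → at w (x + d) ≡ just c → Between w c x q
    between-from-density w x q d c 0<d d≤3 x+4<q e = x + d , inj₁ (m<m+n x 0<d , <-trans (+-monoʳ-< x (s≤s d≤3)) x+4<q) , e

    far-between : ∀ {j p p′} → Match j p p′ → ∀ q q′ → p + 4 < q → p′ + 4 < q′ → q < length w₁ → q′ < length w₂ → ∀ c → Between w₂ c p′ q′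
    far-between {j} {p} {p′} (_ , W , _) q q′ p+4<q p′+4<q′ q<ℓ₁ q′<ℓ₂ c = via dense
      where
      via : Dense w₁ ⊎ Dense w₂ → Between w₂ c p′ q′
      via (inj₂ dense₂) =
        let d , 0<d , d≤3 , e = dense₂ p′ c (≤-trans (≤-reflexive (+-comm 4 p′)) (<⇒≤ (<-trans p′+4<q′ q′<ℓ₂)))
        in between-from-density w₂ p′ q′ d c 0<d d≤3 p′+4<q′ e
      via (inj₁ dense₁) =
        let d , 0<d , d≤3 , e = dense₁ p c (≤-trans (≤-reflexive (+-comm 4 p)) (<⇒≤ (<-trans p+4<q q<ℓ₁)))
        in between-from-density w₂ p′ q′ d c 0<d d≤3 p′+4<q′ (trans (sym (proj₁ (Window.within W d (≤-trans d≤3 (≤-trans (n≤1+n 3) (4≤radius j)))))) e)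

    weaken : ∀ {j p p′} → Match (suc j) p p′ → Match j p p′
    weaken {j} (1+j≤k , W , inj₁ e)          = ≤-trans (n≤1+n _) 1+j≤k , Window-mono (m≤n+m _ 4) W , inj₁ e
    weaken {j} (1+j≤k , W , inj₂ (dp , dp′)) = ≤-trans (n≤1+n _) 1+j≤k , Window-mono (m≤n+m _ 4) W , inj₂ (Deep-weaken j dp , Deep-weaken j dp′)

    shift-right : ∀ {j p p′} → Match (suc j) p p′ → ∀ t → t ≤ 4 → p + t < length w₁ → Match j (p + t) (p′ + t)
    shift-right {j} (1+j≤k , W , sd) t t≤4 _ = ≤-trans (n≤1+n _) 1+j≤k , Window-shiftʳ t (+-monoˡ-≤ (radius j) t≤4) W , shifted sd
      where
      shifted : ∀ {p p′} → SameOrDeep (suc j) p p′ → SameOrDeep j (p + t) (p′ + t)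
      shifted (inj₁ e)          = inj₁ (cong (_+ t) e)
      shifted (inj₂ (dp , dp′)) = inj₂ (Deep-shiftʳ j t t≤4 dp , Deep-shiftʳ j t t≤4 dp′)

    shift-left : ∀ {j p p′} → Match (suc j) p p′ → ∀ t → t ≤ 4 → t ≤ p → t ≤ p′ × Match j (p ∸ t) (p′ ∸ t)
    shift-left {j} (1+j≤k , W , inj₁ refl) t t≤4 t≤p =
      t≤p , ≤-trans (n≤1+n _) 1+j≤k , Window-shiftˡ t (+-monoˡ-≤ (radius j) t≤4) t≤p t≤p W , inj₁ refl
    shift-left {j} (1+j≤k , W , inj₂ (dp , dp′)) t t≤4 t≤p =
      let _ , dp-t = Deep-shiftˡ j t t≤4 dp
          t≤p′ , dp′-t = Deep-shiftˡ j t t≤4 dp′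
      in t≤p′ , ≤-trans (n≤1+n _) 1+j≤k , Window-shiftˡ t (+-monoˡ-≤ (radius j) t≤4) t≤p t≤p′ W , inj₂ (dp-t , dp′-t)

    stay : ∀ {j} → j ≤ k → ∀ i → i < length w₁ → i + R ≤ s ⊎ 3 + s + R ≤ i → i < length w₂ × Match j i i
    stay {j} j≤k i i<ℓ₁ away = subst (i <_) (trans ℓ₁ (sym ℓ₂)) i<ℓ₁ , j≤k , Window-outside s agree (radius j) i (narrow away) , inj₁ refl
      where
      narrow : i + R ≤ s ⊎ 3 + s + R ≤ i → i + radius j ≤ s ⊎ 3 + s + radius j ≤ i
      narrow (inj₁ left)  = inj₁ (≤-trans (+-monoʳ-≤ i (radius≤R j j≤k)) left)
      narrow (inj₂ right) = inj₂ (≤-trans (+-monoʳ-≤ (3 + s) (radius≤R j j≤k)) right)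

    stay-left : ∀ {j} → j ≤ k → ∀ i → i < length w₁ → i ≤ margin j + m + 4 → ∀ {P : ℕ → Set} → P i → ∃ λ i′ → i′ < length w₂ × P i′ × Match j i i′
    stay-left {j} j≤k i i<ℓ₁ i≤ Pi =
      let i<ℓ₂ , match = stay j≤k i i<ℓ₁ (inj₁ (left-of-swap j j≤k i i≤))
      in i , i<ℓ₂ , Pi , match

    stay-right′ : ∀ {j} → j ≤ k → ∀ i → i < length w₁ → 3 + s + R ≤ i → ∀ {P : ℕ → Set} → P i → ∃ λ i′ → i′ < length w₂ × P i′ × Match j i i′
    stay-right′ j≤k i i<ℓ₁ right Pi = let i<ℓ₂ , match = stay j≤k i i<ℓ₁ (inj₂ right) in i , i<ℓ₂ , Pi , match

    stay-right : ∀ {j} → j ≤ k → ∀ i → i < length w₁ → ℓ ≤ i + margin j → ∀ {P : ℕ → Set} → P i → ∃ λ i′ → i′ < length w₂ × P i′ × Match j i i′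
    stay-right {j} j≤k i i<ℓ₁ ℓ≤i+E = stay-right′ j≤k i i<ℓ₁ (right-of-swap j j≤k i ℓ≤i+E)

    -- Deep positions are answered by a copy of their window in the first
    -- block after the left margin, or in the last block before the right one.
    copy-left : ∀ j → j ≤ k → ∀ i → Deep j i → ∀ {p′} → margin j + m + 4 ≤ p′ →
                ∃ λ i′ → i′ < length w₂ × i′ + 4 < p′ × Match j i i′
    copy-left j j≤k i deep E+m+4≤p′ =
      let i′ , E≤i′ , i′<E+m , W′ = copy-into-block j j≤k i deep (blocks j) (R≤margin j)
                                      (≤-trans (margin+m+R≤s j j≤k) s≤ℓ) (inj₁ (margin+m+R≤s j j≤k))
          i′+E<ℓ = first-blocks-deep j j≤k i′ i′<E+m
      in i′ , subst (i′ <_) (sym ℓ₂) (≤-<-trans (m≤m+n i′ (margin j)) i′+E<ℓ) , <-≤-trans (+-monoˡ-< 4 i′<E+m) E+m+4≤p′ ,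
         j≤k , W′ , inj₂ (deep , (E≤i′ , i′+E<ℓ))

    copy-right : ∀ j → j ≤ k → ∀ i → Deep j i → ∀ {p′} → p′ + 5 ≤ farBlock j * m →
                 ∃ λ i′ → i′ < length w₂ × p′ + 4 < i′ × Match j i i′
    copy-right j j≤k i deep {p′} p′+5≤βm =
      let i′ , βm≤i′ , i′<βm+m , W′ = copy-into-block j j≤k i deep (farBlock j) R≤βm βm+m+R≤ℓ (inj₂ (swap-left-of-farBlock j j≤k))
          i′+E<ℓ = subst (i′ + margin j <_) (farBlock-end j j≤k) (+-monoˡ-< (margin j) i′<βm+m)
      in i′ , subst (i′ <_) (sym ℓ₂) (≤-<-trans (m≤m+n i′ (margin j)) i′+E<ℓ) , ≤-trans (subst (_≤ farBlock j * m) (+-suc p′ 4) p′+5≤βm) βm≤i′ ,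
         j≤k , W′ , inj₂ (deep , (≤-trans E≤βm βm≤i′ , i′+E<ℓ))
      where
      R≤βm : R ≤ farBlock j * m
      R≤βm = ≤-trans (m≤n+m R (3 + s)) (swap-left-of-farBlock j j≤k)
      βm+m+R≤ℓ : farBlock j * m + m + R ≤ ℓ
      βm+m+R≤ℓ = subst (farBlock j * m + m + R ≤_) (farBlock-end j j≤k) (+-monoʳ-≤ (farBlock j * m + m) (R≤margin j))
      E≤βm : margin j ≤ farBlock j * m
      E≤βm = ≤-trans (≤-trans (m≤m+n (margin j) _) (≤-trans (m≤m+n _ R) (margin+m+R≤s j j≤k)))
                     (≤-trans (≤-trans (m≤n+m s 3) (m≤m+n _ R)) (swap-left-of-farBlock j j≤k))

    jump-left : ∀ {j p p′} → Match (suc j) p p′ → ∀ i → i < length w₁ → i + 4 < p →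
                ∃ λ i′ → i′ < length w₂ × i′ + 4 < p′ × Match j i i′
    jump-left (1+j≤k , _ , sd) = jump-left′ (≤-trans (n≤1+n _) 1+j≤k) sd
      where
      jump-left′ : ∀ {j p p′} → j ≤ k → SameOrDeep (suc j) p p′ → ∀ i → i < length w₁ → i + 4 < p →
                   ∃ λ i′ → i′ < length w₂ × i′ + 4 < p′ × Match j i i′
      jump-left′ {j} {p} {p′} j≤k sd i i<ℓ₁ i+4<p with i <? margin j | i + margin j <? ℓ | margin j + m + 4 ≤? p′ | sd
      ... | yes i<E | _ | _ | inj₁ refl = stay-left j≤k i i<ℓ₁ (<margin⇒≤margin+m+4 j i<E) i+4<p
      ... | yes i<E | _ | _ | inj₂ (_ , dp′) =
        stay-left j≤k i i<ℓ₁ (<margin⇒≤margin+m+4 j i<E) (<-≤-trans (+-monoˡ-< 4 i<E) (≤-trans (≤-trans (+-monoˡ-≤ 4 (m≤m+n (margin j) m)) (margin+m+4≤margin-suc j)) (proj₁ dp′)))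
      ... | no i≮E | yes i+E<ℓ | yes E+m+4≤p′ | _ = copy-left j j≤k i (≮⇒≥ i≮E , i+E<ℓ) E+m+4≤p′
      ... | no _ | yes _ | no E+m+4≰p′ | inj₁ refl = stay-left j≤k i i<ℓ₁ (≤-trans (m≤m+n i 4) (<⇒≤ (<-trans i+4<p (≰⇒> E+m+4≰p′)))) i+4<p
      ... | no _ | yes _ | no E+m+4≰p′ | inj₂ (_ , dp′) = ⊥-elim (E+m+4≰p′ (≤-trans (margin+m+4≤margin-suc j) (proj₁ dp′)))
      ... | no _ | no i+E≮ℓ | _ | inj₁ refl = stay-right j≤k i i<ℓ₁ (≮⇒≥ i+E≮ℓ) i+4<p
      ... | no _ | no i+E≮ℓ | _ | inj₂ ((_ , p+E<ℓ) , _) =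
        ⊥-elim (<-irrefl refl (<-≤-trans p+E<ℓ (≤-trans (≮⇒≥ i+E≮ℓ) (+-mono-≤ (≤-trans (m≤m+n i 4) (<⇒≤ i+4<p)) (margin≤margin-suc j)))))

    jump-right : ∀ {j p p′} → Match (suc j) p p′ → ∀ i → i < length w₁ → p + 4 < i →
                 ∃ λ i′ → i′ < length w₂ × p′ + 4 < i′ × Match j i i′
    jump-right (1+j≤k , _ , sd) = jump-right′ (≤-trans (n≤1+n _) 1+j≤k) sd
      where
      jump-right′ : ∀ {j p p′} → j ≤ k → SameOrDeep (suc j) p p′ → ∀ i → i < length w₁ → p + 4 < i →
                    ∃ λ i′ → i′ < length w₂ × p′ + 4 < i′ × Match j i i′
      jump-right′ {j} {p} {p′} j≤k sd i i<ℓ₁ p+4<i with i <? margin j | i + margin j <? ℓ | p′ + 5 ≤? farBlock j * m | sd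
      ... | yes i<E | _ | _ | inj₁ refl = stay-left j≤k i i<ℓ₁ (<margin⇒≤margin+m+4 j i<E) p+4<i
      ... | yes i<E | _ | _ | inj₂ ((E≤p , _) , _) =
        ⊥-elim (<-irrefl refl (<-trans (≤-<-trans (≤-trans (margin≤margin-suc j) E≤p) (≤-<-trans (m≤m+n p 4) p+4<i)) i<E))
      ... | no i≮E | yes i+E<ℓ | yes p′+5≤βm | _ = copy-right j j≤k i (≮⇒≥ i≮E , i+E<ℓ) p′+5≤βm
      ... | no _ | yes _ | no p′+5≰βm | inj₁ refl =
        stay-right′ j≤k i i<ℓ₁ (≤-trans (swap-left-of-farBlock j j≤k) (≤-trans (≤-pred (subst (suc (farBlock j * m) ≤_) (+-suc p 4) (≰⇒> p′+5≰βm))) (<⇒≤ p+4<i))) p+4<i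
      ... | no _ | yes _ | no p′+5≰βm | inj₂ (_ , (_ , p′+E<ℓ)) =
        ⊥-elim (p′+5≰βm (≤-trans (+-monoʳ-≤ p′ (≤-trans (m≤m+n 5 R) 5+R≤m)) (<⇒≤ (deep-before-farBlock j j≤k p′+E<ℓ))))
      ... | no _ | no i+E≮ℓ | _ | inj₁ refl = stay-right j≤k i i<ℓ₁ (≮⇒≥ i+E≮ℓ) p+4<i
      ... | no _ | no i+E≮ℓ | _ | inj₂ (_ , (_ , p′+E<ℓ)) = stay-right j≤k i i<ℓ₁ (≮⇒≥ i+E≮ℓ) (+-cancelʳ-< (margin j) (p′ + 4) i
          (<-≤-trans (≤-<-trans (≤-trans (≤-reflexive (+-assoc p′ 4 (margin j))) (+-monoʳ-≤ p′ (margin-suc j 4 ≤-refl))) p′+E<ℓ) (≮⇒≥ i+E≮ℓ)))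

    simulation : Simulation w₁ w₂ Match
    simulation = record
      { same-letter  = same-letter
      ; near-between = near-between
      ; far-between  = far-between
      ; weaken       = weaken
      ; shift-right  = shift-right
      ; shift-left   = shift-left
      ; jump-left    = jump-left
      ; jump-right   = jump-right
      }

  module UV = Simulating u v refl length-v agree-u-v agree-u-v (inj₁ u-dense) u-SeenInU
  module VU = Simulating v u length-v refl agree-v-u (λ _ _ _ → refl) (inj₂ u-dense) v-SeenInU

  simulation-v-u : Simulation v u (Converse UV.Match)
  simulation-v-u = Simulation-resp flip flip VU.simulation
    where
    flip : ∀ {w w′ j p p′} → j ≤ k × Window (radius j) w p w′ p′ × SameOrDeep j p p′ → j ≤ k × Window (radius j) w′ p′ w p × SameOrDeep j p′ p
    flip {j = j} (j≤k , W , sd) = j≤k , Window-sym W , SameOrDeep-sym {j} sd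

  initial-configuration : Configuration u v UV.Match k 0 0 0 0
  initial-configuration = configuration matched matched (inj₁ (0 , z≤n , refl , refl)) 0<ℓ 0<ℓ
    where
    matched : UV.Match k 0 0
    matched = ≤-refl , Window-outside s agree-u-v (radius k) 0 (inj₁ (left-of-swap k ≤-refl 0 z≤n)) , inj₁ refl
    0<ℓ : 0 < length u
    0<ℓ = ≤-<-trans z≤n s+R<ℓ

indistinguishable : ∀ k → ∃ λ u → ∃ λ v → InL u × ¬ InL v ×
                    (∀ (φ : FO2 emptyScope) → qdepth φ ≤ k → satFO2 φ u noVars2 → satFO2 φ v noVars2)
indistinguishable k = u , v , run⇒InL u run-u , v∉L , transfer
  where
  open Construction k
  v∉L : ¬ InL v
  v∉L v∈L with trans (sym run-v) (InL⇒run v∈L)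
  ... | ()
  no-vars : ∀ x y → Agree {emptyScope} noVars2 x y
  no-vars x y _ ()
  transfer : ∀ (φ : FO2 emptyScope) → qdepth φ ≤ k → satFO2 φ u noVars2 → satFO2 φ v noVars2
  transfer φ d≤k = simulation-preserves UV.simulation simulation-v-u φ k d≤k noVars2 noVars2 0 0 0 0 (no-vars 0 0) (no-vars 0 0) initial-configuration

L-not-FO2-definable : ¬ FO2BetDefinable InL
L-not-FO2-definable (φ , defines) =
  let u , v , u∈L , v∉L , transfer = indistinguishable (qdepth φ)
  in v∉L (Equivalence.from (defines v) (transfer φ ≤-refl (Equivalence.to (defines u) u∈L)))

corollary6p3 : FODefinable InL × ¬ FO2BetDefinable InL
corollary6p3 = L-FO-definable , L-not-FO2-definable
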